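{- For the ticker tape $\mathcal{X}$ of any independent set of $\mathcal{C}_n$, the integers $\deg(\mathcal{X})$ and $\mathrm{codeg}(\mathcal{X})$ are relatively prime.
   Context: Let $n\ge2$ and $\mathcal{C}_n$ the cycle graph on $\mathbb{Z}_n=\{1,\dots,n\}$ with edges $\{i,i+1\}$ (mod $n$). Independent sets are binary vectors $x\in\{0,1\}^n$ with no two cyclically adjacent $1$s. The toggle $\tau_k$ changes $x_k$ from $1$ to $0$, from $0$ to $1$ if the result is independent, otherwise does nothing; $\tau=\tau_n\circ\cdots\circ\tau_1$, $x^{(i)}=\tau^i(x)$. The ticker tape is $(X_k)_{k\in\mathbb{Z}}$ with $X_{in+j}$ the $j$-th entry of $x^{(i)}$ ($1\le j\le n$); $k$ is live if $X_k=1$. Successor $s$: live $k\mapsto$ the unique live element of $\{k+2,k+n+1\}$; co-successor $c$: live $k\mapsto$ the unique live element of $\{k+2n-2,k+2n-1\}$. Snakes/co-snakes are orbits of $s$/$c$, numbers $\alpha$/$\beta$. Step $k\to s(k)$ has type $E$ if $s(k)=k+2$, $D$ if $s(k)=k+n+1$; step $k\to c(k)$ has type $S$ if $c(k)=k+2n-1$, $L$ if $c(k)=k+2n-2$. The slither from live $k$ is the word of step types of $k\to s(k)\to\dots\to s^\beta(k)$, the co-slither the word of step types of $k\to c(k)\to\dots\to c^\alpha(k)$. $\deg(\mathcal{X})$ is the length of the slither divided by its period as a cyclic word, and $\mathrm{codeg}(\mathcal{X})$ the length of the co-slither divided by its period as a cyclic word (both independent of $k$). -}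

module Defs where

open import Data.Bool using (Bool; true; false; _∧_; if_then_else_)
open import Data.Nat using (ℕ; zero; suc; _≤_; _<_; NonZero; _%_)
import Data.Nat as ℕ
open import Data.Nat.DivMod using (m%n<n)
open import Data.Fin using (Fin; toℕ; fromℕ<; _≟_)
open import Data.Fin.Properties using (all?)
open import Data.Integer using (ℤ; +_; -[1+_]; _+_; _-_; _*_)
open import Data.Integer.DivMod using (_/ℕ_; _%ℕ_; n%ℕd<d)
open import Data.List using (List; []; _∷_; _++_; [_]; foldl; foldr; allFin; length)
open import Data.Product using (Σ; ∃; _×_; _,_)
open import Relation.Nullary using (¬_; yes; no; does)
open import Relation.Binary.PropositionalEquality using (_≡_; _≢_)

iter : ∀ {A : Set} → (A → A) → ℕ → A → A
iter f zero    a = a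
iter f (suc m) a = f (iter f m a)

-- The cycle graph C_n on Fin n (vertex j+1 of the paper is index j)

module _ (n : ℕ) .{{_ : NonZero n}} where

  csucc : Fin n → Fin n
  csucc i = fromℕ< (m%n<n (suc (toℕ i)) n)

  -- binary vectors x ∈ {0,1}^n  (true = 1)
  Config : Set
  Config = Fin n → Bool

  Independent : Config → Set
  Independent x = ∀ i → x i ∧ x (csucc i) ≡ false

  update : Config → Fin n → Bool → Config
  update x k b j = if does (j ≟ k) then b else x j

  toggle : Fin n → Config → Config
  toggle k x with x k
  ... | true  = update x k false
  ... | false with all? (λ i → Data.Bool._≟_ (update x k true i ∧ update x k true (csucc i)) false)
  ...   | yes _ = update x k true
  ...   | no  _ = x

  -- τ = τ_n ∘ ⋯ ∘ τ_1  (τ_1 applied first)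
  sweep : Config → Config
  sweep x = foldl (λ y k → toggle k y) x (allFin n)

  -- τ⁻¹ = τ_1 ∘ ⋯ ∘ τ_n  (each τ_k is an involution on independent sets)
  unsweep : Config → Config
  unsweep x = foldr (λ k y → toggle k y) x (allFin n)

  orbitPt : Config → ℤ → Config
  orbitPt x (+ i)      = iter sweep i x
  orbitPt x -[1+ i ]   = iter unsweep (suc i) x

  -- ticker tape: X_{in+j} = j-th entry of x^{(i)}, 1 ≤ j ≤ n;
  -- i.e. for k ∈ ℤ, i = ⌊(k-1)/n⌋ and j-1 = (k-1) mod n
  tape : Config → ℤ → Bool
  tape x k = orbitPt x ((k - + 1) /ℕ n) (fromℕ< (n%ℕd<d (k - + 1) n))

  Live : Config → ℤ → Set
  Live x k = tape x k ≡ true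

  -- successor: live k ↦ the (unique) live element of {k+2, k+n+1}
  succ : Config → ℤ → ℤ
  succ x k = if tape x (k + + 2) then k + + 2 else k + + n + + 1

  -- co-successor: live k ↦ the (unique) live element of {k+2n-2, k+2n-1}
  cosucc : Config → ℤ → ℤ
  cosucc x k = if tape x (k + + 2 * + n - + 1)
                 then k + + 2 * + n - + 1
                 else k + + 2 * + n - + 2

data SType : Set where
  E D : SType

data CType : Set where
  S L : CType

module _ (n : ℕ) .{{_ : NonZero n}} where

  sType : Config n → ℤ → SType
  sType x k = if tape n x (k + + 2) then E else D

  cType : Config n → ℤ → CType
  cType x k = if tape n x (k + + 2 * + n - + 1) then S else L

  stepWord : ∀ {T : Set} → (ℤ → ℤ) → (ℤ → T) → ℤ → ℕ → List T
  stepWord f ty k zero    = []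
  stepWord f ty k (suc m) = ty k ∷ stepWord f ty (f k) m

  slither : Config n → ℤ → ℕ → List SType
  slither x k β = stepWord (succ n x) (sType x) k β

  coslither : Config n → ℤ → ℕ → List CType
  coslither x k α = stepWord (cosucc n x) (cType x) k α

  SameOrbit : (ℤ → ℤ) → ℤ → ℤ → Set
  SameOrbit f k k' = ∃ λ a → ∃ λ b → iter f a k ≡ iter f b k'

  NumOrbits : Config n → (ℤ → ℤ) → ℕ → Set
  NumOrbits x f N =
    Σ (Fin N → ℤ) λ rep →
      (∀ i → Live n x (rep i)) ×
      (∀ i j → i ≢ j → ¬ SameOrbit f (rep i) (rep j)) ×
      (∀ k → Live n x k → ∃ λ i → SameOrbit f k (rep i))

  NumSnakes : Config n → ℕ → Set
  NumSnakes x α = NumOrbits x (succ n x) α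

  NumCoSnakes : Config n → ℕ → Set
  NumCoSnakes x β = NumOrbits x (cosucc n x) β

rot1 : ∀ {A : Set} → List A → List A
rot1 []       = []
rot1 (a ∷ as) = as ++ [ a ]

IsCyclicPeriod : ∀ {A : Set} → List A → ℕ → Set
IsCyclicPeriod w p =
  1 ≤ p × iter rot1 p w ≡ w × (∀ q → 1 ≤ q → iter rot1 q w ≡ w → p ≤ q)

LengthOverPeriod : ∀ {A : Set} → List A → ℕ → Set
LengthOverPeriod w d = ∃ λ p → IsCyclicPeriod w p × length w ≡ d ℕ.* p

IsDeg : (n : ℕ) .{{_ : NonZero n}} → Config n → ℤ → ℕ → ℕ → Set
IsDeg n x k β d = LengthOverPeriod (slither n x k β) d

IsCodeg : (n : ℕ) .{{_ : NonZero n}} → Config n → ℤ → ℕ → ℕ → Set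
IsCodeg n x k α e = LengthOverPeriod (coslither n x k α) e

module Submission where

-- The only fact used about toggling is that the ticker tape satisfies
-- X k = ¬ (X (k - 1) ∨ X (k - n) ∨ X (k - n + 1)).  From this recurrence,
-- the successor s and the co-successor c are increasing injections of the live
-- positions that commute, and any two live positions are joined by s- and
-- c-steps.  So c permutes the α snakes cyclically: c^α k is the first c-power
-- of k back on the snake of k, and symmetrically for s and β; thus
-- s^β k = c^α k, and the slither and co-slither repeat along the orbits.  If
-- i ≥ 2 divided both degrees, s^(β/i) k and c^(α/i) k would both equal k plus
-- an i-th of the common displacement s^β k - k, an early return of the
-- co-snake of k to its snake.

import Data.Nat as ℕ
open import Data.Nat using (ℕ; NonZero)
open import Data.Integer using (ℤ)
open import Data.Bool using (Bool)
open import Defs using (Config; tape)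

module Iteration where

  open import Defs using (iter)
  open import Data.Nat using (ℕ; zero; suc; _+_; _∸_)
  open import Data.Nat.Properties using (m∸n+n≡m; m+[n∸m]≡n)
  open import Data.Integer using (ℤ; _<_; _≤_)
  open import Data.Integer.Properties using (≤-refl; ≤-trans; <-trans; <⇒≤)
  open import Relation.Binary.PropositionalEquality

  iter-+ : ∀ {A : Set} (f : A → A) m n a → iter f (m + n) a ≡ iter f m (iter f n a)
  iter-+ f zero    n a = refl
  iter-+ f (suc m) n a = cong f (iter-+ f m n a)

  iter-split : ∀ {A : Set} (f : A → A) {m n} → m ℕ.≤ n → ∀ a → iter f n a ≡ iter f m (iter f (n ∸ m) a)
  iter-split f {m} {n} m≤n a = trans (cong (λ t → iter f t a) (sym (m+[n∸m]≡n m≤n))) (iter-+ f m (n ∸ m) a)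

  iter-suc : ∀ {A : Set} (f : A → A) m a → iter f m (f a) ≡ iter f (suc m) a
  iter-suc f zero    a = refl
  iter-suc f (suc m) a = cong f (iter-suc f m a)

  module _ {A : Set} (P : A → Set) where

    Invariant : (A → A) → Set
    Invariant f = ∀ a → P a → P (f a)

    InjectiveOn : (A → A) → Set
    InjectiveOn f = ∀ a b → P a → P b → f a ≡ f b → a ≡ b

    CommuteOn : (A → A) → (A → A) → Set
    CommuteOn f g = ∀ a → P a → f (g a) ≡ g (f a)

  module _ {A : Set} {P : A → Set} where

    iter-invariant : ∀ {f} → Invariant P f → ∀ m → Invariant P (iter f m)
    iter-invariant f-inv zero    a p = p
    iter-invariant f-inv (suc m) a p = f-inv _ (iter-invariant f-inv m a p)

    iter-injectiveOn : ∀ {f} → Invariant P f → InjectiveOn P f → ∀ m → InjectiveOn P (iter f m)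
    iter-injectiveOn f-inv f-inj zero    a b pa pb e = e
    iter-injectiveOn f-inv f-inj (suc m) a b pa pb e =
      iter-injectiveOn f-inv f-inj m a b pa pb
        (f-inj _ _ (iter-invariant f-inv m a pa) (iter-invariant f-inv m b pb) e)

    iter-commuteOn : ∀ {f g} → Invariant P f → Invariant P g → CommuteOn P f g →
                     ∀ a b → CommuteOn P (iter f a) (iter g b)
    iter-commuteOn {f} {g} f-inv g-inv comm a = commute-both
      where
        commute-one : ∀ a → CommuteOn P (iter f a) g
        commute-one zero    x p = refl
        commute-one (suc a) x p = trans (cong f (commute-one a x p)) (comm _ (iter-invariant f-inv a x p))

        commute-both : ∀ b → CommuteOn P (iter f a) (iter g b)
        commute-both zero    x p = refl
        commute-both (suc b) x p =
          trans (commute-one a _ (iter-invariant g-inv b x p)) (cong g (commute-both b x p))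

  Inflationary : (ℤ → ℤ) → Set
  Inflationary f = ∀ y → y < f y

  module _ {f : ℤ → ℤ} (f-infl : Inflationary f) where

    iter-inflationary : ∀ m y → y < iter f (suc m) y
    iter-inflationary zero    y = f-infl y
    iter-inflationary (suc m) y = <-trans (iter-inflationary m y) (f-infl _)

    iter-monotone : ∀ {p q} y → p ℕ.≤ q → iter f p y ≤ iter f q y
    iter-monotone {p} {q} y p≤q =
      subst (λ r → iter f p y ≤ iter f r y) (m∸n+n≡m p≤q) (climb (q ∸ p))
      where
        climb : ∀ d → iter f p y ≤ iter f (d + p) y
        climb zero    = ≤-refl
        climb (suc d) = ≤-trans (climb d) (<⇒≤ (f-infl _))

  iter-constant : ∀ {A B : Set} {P : A → Set} {g : A → A} (h : A → B) → Invariant P g →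
                  (∀ a → P a → h (g a) ≡ h a) → ∀ t a → P a → h (iter g t a) ≡ h a
  iter-constant h g-inv h∘g zero    a pa = refl
  iter-constant h g-inv h∘g (suc t) a pa =
    trans (h∘g _ (iter-invariant g-inv t a pa)) (iter-constant h g-inv h∘g t a pa)

open Iteration

module OrbitCounting where

  open import Defs using (iter)
  open import Data.Nat using (ℕ; zero; suc; z≤n; s≤s; _+_; _*_; _∸_; _%_; _/_; NonZero)
  open import Data.Nat.Properties as ℕ
    using (m∸n≤m; m<n⇒0<n∸m; <⇒≤; n<1+n; ≤-pred; ≤-total; +-comm; *-suc)
  open import Data.Nat.DivMod using (m≡m%n+[m/n]*n; m%n<n; _mod_)
  open import Data.Integer using (ℤ; _≤_)
  open import Data.Integer.Properties using (<-irrefl; <-≤-trans; ≤-antisym; ≤-trans; ≤-reflexive)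
  open import Data.Fin using (Fin; toℕ)
  open import Data.Fin.Properties using (pigeonhole; toℕ-fromℕ<; toℕ<n; <⇒≢)
  open import Data.Product using (Σ; ∃; ∃₂; _×_; _,_; proj₁; proj₂)
  open import Data.Sum using (_⊎_; inj₁; inj₂)
  open import Data.Empty using (⊥-elim)
  open import Relation.Nullary using (¬_)
  open import Relation.Binary.PropositionalEquality
  open ≡-Reasoning

  module _ {A : Set} where

    SameOrbitOf : (A → A) → A → A → Set
    SameOrbitOf f u v = ∃₂ λ a b → iter f a u ≡ iter f b v

    HasOrbits : (A → Set) → (A → A) → ℕ → Set
    HasOrbits P f N =
      Σ (Fin N → A) λ rep →
        (∀ i → P (rep i)) ×
        (∀ i j → i ≢ j → ¬ SameOrbitOf f (rep i) (rep j)) ×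
        (∀ k → P k → ∃ λ i → SameOrbitOf f k (rep i))

    GridMeet : (A → A) → (A → A) → A → A → Set
    GridMeet f g u v = ∃₂ λ a b → ∃₂ λ a′ b′ → iter f a (iter g b u) ≡ iter f a′ (iter g b′ v)

    module _ {f : A → A} where

      sameOrbit-refl : ∀ u → SameOrbitOf f u u
      sameOrbit-refl u = 0 , 0 , refl

      sameOrbit-sym : ∀ {u v} → SameOrbitOf f u v → SameOrbitOf f v u
      sameOrbit-sym (a , b , e) = b , a , sym e

      sameOrbit-trans : ∀ {u v w} → SameOrbitOf f u v → SameOrbitOf f v w → SameOrbitOf f u w
      sameOrbit-trans {u} {v} {w} (a , b , e) (a′ , b′ , e′) = a′ + a , b + b′ , (begin
        iter f (a′ + a) u        ≡⟨ iter-+ f a′ a u ⟩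
        iter f a′ (iter f a u)   ≡⟨ cong (iter f a′) e ⟩
        iter f a′ (iter f b v)   ≡⟨ iter-+ f a′ b v ⟨
        iter f (a′ + b) v        ≡⟨ cong (λ t → iter f t v) (+-comm a′ b) ⟩
        iter f (b + a′) v        ≡⟨ iter-+ f b a′ v ⟩
        iter f b (iter f a′ v)   ≡⟨ cong (iter f b) e′ ⟩
        iter f b (iter f b′ w)   ≡⟨ iter-+ f b b′ w ⟨
        iter f (b + b′) w        ∎)

      orbitCount-pos : ∀ {P : A → Set} {α k} → HasOrbits P f α → P k → NonZero α
      orbitCount-pos {α = suc _} _ _ = _
      orbitCount-pos {α = zero} (_ , _ , _ , cover) pk with () ← cover _ pk

  module GridMeeting {A : Set} {P : A → Set} {f g : A → A}
    (f-inv : Invariant P f) (g-inv : Invariant P g) (comm : CommuteOn P f g) where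

    private
      grid : ℕ → ℕ → A → A
      grid a b u = iter f a (iter g b u)

      grid-grid : ∀ a b a′ b′ {u} → P u → grid a b (grid a′ b′ u) ≡ grid (a + a′) (b + b′) u
      grid-grid a b a′ b′ {u} pu = begin
        iter f a (iter g b (iter f a′ (iter g b′ u)))
          ≡⟨ cong (iter f a) (iter-commuteOn f-inv g-inv comm a′ b _ (iter-invariant g-inv b′ u pu)) ⟨
        iter f a (iter f a′ (iter g b (iter g b′ u)))
          ≡⟨ iter-+ f a a′ _ ⟨
        iter f (a + a′) (iter g b (iter g b′ u))
          ≡⟨ cong (iter f (a + a′)) (iter-+ g b b′ u) ⟨
        iter f (a + a′) (iter g (b + b′) u) ∎

    gridMeet-refl : ∀ u → GridMeet f g u u
    gridMeet-refl u = 0 , 0 , 0 , 0 , refl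

    gridMeet-sym : ∀ {u v} → GridMeet f g u v → GridMeet f g v u
    gridMeet-sym (a , b , a′ , b′ , e) = a′ , b′ , a , b , sym e

    gridMeet-trans : ∀ {u v w} → P u → P v → P w → GridMeet f g u v → GridMeet f g v w → GridMeet f g u w
    gridMeet-trans {u} {v} {w} pu pv pw (a₁ , b₁ , a₂ , b₂ , e₁) (a₃ , b₃ , a₄ , b₄ , e₂) =
      a₃ + a₁ , b₃ + b₁ , a₂ + a₄ , b₂ + b₄ , (begin
        grid (a₃ + a₁) (b₃ + b₁) u  ≡⟨ grid-grid a₃ b₃ a₁ b₁ pu ⟨
        grid a₃ b₃ (grid a₁ b₁ u)   ≡⟨ cong (grid a₃ b₃) e₁ ⟩
        grid a₃ b₃ (grid a₂ b₂ v)   ≡⟨ grid-grid a₃ b₃ a₂ b₂ pv ⟩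
        grid (a₃ + a₂) (b₃ + b₂) v  ≡⟨ cong₂ (λ a b → grid a b v) (+-comm a₃ a₂) (+-comm b₃ b₂) ⟩
        grid (a₂ + a₃) (b₂ + b₃) v  ≡⟨ grid-grid a₂ b₂ a₃ b₃ pv ⟨
        grid a₂ b₂ (grid a₃ b₃ v)   ≡⟨ cong (grid a₂ b₂) e₂ ⟩
        grid a₂ b₂ (grid a₄ b₄ w)   ≡⟨ grid-grid a₂ b₂ a₄ b₄ pw ⟩
        grid (a₂ + a₄) (b₂ + b₄) w  ∎)

    gridMeet-swap : ∀ {u v} → P u → P v → GridMeet f g u v → GridMeet g f u v
    gridMeet-swap pu pv (a , b , a′ , b′ , e) =
      b , a , b′ , a′ , trans (sym (iter-commuteOn f-inv g-inv comm a b _ pu))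
                          (trans e (iter-commuteOn f-inv g-inv comm a′ b′ _ pv))

  -- The f-orbits of the live points are permuted by g; when that permutation is
  -- transitive and g increases positions, g^α returns k to its own f-orbit
  -- (α the number of f-orbits) and no smaller positive power does.
  module CommutingMaps
    (Live : ℤ → Set) {f g : ℤ → ℤ}
    (f-live : Invariant Live f) (g-live : Invariant Live g)
    (f-inj : InjectiveOn Live f) (g-inj : InjectiveOn Live g)
    (fg-comm : CommuteOn Live f g) (f-infl : Inflationary f) (g-infl : Inflationary g)
    (grid : ∀ {u v} → Live u → Live v → GridMeet f g u v)
    where

    commute : ∀ a b {u} → Live u → iter f a (iter g b u) ≡ iter g b (iter f a u)
    commute a b = iter-commuteOn f-live g-live fg-comm a b _

    iter-g-sameOrbit : ∀ t {u v} → Live u → Live v →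
                       SameOrbitOf f u v → SameOrbitOf f (iter g t u) (iter g t v)
    iter-g-sameOrbit t lu lv (a , b , e) =
      a , b , trans (commute a t lu) (trans (cong (iter g t) e) (sym (commute b t lv)))

    iter-g-sameOrbit⁻ : ∀ t {u v} → Live u → Live v →
                        SameOrbitOf f (iter g t u) (iter g t v) → SameOrbitOf f u v
    iter-g-sameOrbit⁻ t {u} {v} lu lv (a , b , e) =
      a , b , iter-injectiveOn g-live g-inj t _ _
                (iter-invariant f-live a u lu) (iter-invariant f-live b v lv)
                (trans (sym (commute a t lu)) (trans e (commute b t lv)))

    module _ {k : ℤ} (lk : Live k) where

      g-power : ∀ j → Live (iter g j k)
      g-power j = iter-invariant g-live j k lk

      grid-toward : ∀ {v} → Live v →
                    ∃ λ j → SameOrbitOf f v (iter g j k) ⊎ SameOrbitOf f (iter g j v) k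
      grid-toward {v} lv with grid lv lk
      ... | a , b , a′ , b′ , e with ≤-total b b′
      ...   | inj₁ b≤b′ = b′ ∸ b , inj₁ (iter-g-sameOrbit⁻ b lv (g-power (b′ ∸ b))
                            (a , a′ , trans e (cong (iter f a′) (iter-split g b≤b′ k))))
      ...   | inj₂ b′≤b = b ∸ b′ , inj₂ (iter-g-sameOrbit⁻ b′ (iter-invariant g-live (b ∸ b′) v lv) lk
                            (a , a′ , trans (cong (iter f a) (sym (iter-split g b′≤b v))) e))

      power-return : ∀ l → SameOrbitOf f k (iter g l k) → ∀ q → SameOrbitOf f (iter g (q * l) k) k
      power-return l r zero    = sameOrbit-refl k
      power-return l r (suc q) =
        subst (λ t → SameOrbitOf f t k) (sym (iter-+ g l (q * l) k))
          (sameOrbit-trans (iter-g-sameOrbit l (g-power (q * l)) lk (power-return l r q)) (sameOrbit-sym r))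

      reduce-power : ∀ l .{{_ : NonZero l}} → SameOrbitOf f k (iter g l k) →
                     ∀ j → SameOrbitOf f (iter g j k) (iter g (j % l) k)
      reduce-power l r j =
        subst (λ t → SameOrbitOf f (iter g t k) (iter g (j % l) k)) (sym (m≡m%n+[m/n]*n j l))
          (subst (λ t → SameOrbitOf f t (iter g (j % l) k)) (sym (iter-+ g (j % l) (j / l * l) k))
            (iter-g-sameOrbit (j % l) (g-power (j / l * l)) lk (power-return l r (j / l))))

      meets-some-power : ∀ l → SameOrbitOf f k (iter g (suc l) k) →
                         ∀ {v} → Live v → ∃ λ j → SameOrbitOf f v (iter g j k)
      meets-some-power l r lv with grid-toward lv
      ... | j , inj₁ o = j , o
      ... | j , inj₂ o = j * l , iter-g-sameOrbit⁻ j lv (g-power (j * l))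
                           (sameOrbit-trans o (subst (SameOrbitOf f k) g-split
                             (sameOrbit-sym (power-return (suc l) r j))))
        where
          g-split : iter g (j * suc l) k ≡ iter g j (iter g (j * l) k)
          g-split = trans (cong (λ t → iter g t k) (*-suc j l)) (iter-+ g j (j * l) k)

      module _ {α} (orbits : HasOrbits Live f α) where

        private
          rep = proj₁ orbits
          rep-live = proj₁ (proj₂ orbits)
          rep-distinct = proj₁ (proj₂ (proj₂ orbits))
          cover = proj₂ (proj₂ (proj₂ orbits))

          power : ∀ l → SameOrbitOf f k (iter g (suc l) k) → Fin α → ℕ
          power l r i = proj₁ (meets-some-power l r (rep-live i))

          class-mod : ∀ l → SameOrbitOf f k (iter g (suc l) k) → Fin α → Fin (suc l)
          class-mod l r i = power l r i mod suc l

          rep-meets-class-mod : ∀ l r i → SameOrbitOf f (rep i) (iter g (toℕ (class-mod l r i)) k)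
          rep-meets-class-mod l r i =
            subst (λ t → SameOrbitOf f (rep i) (iter g t k)) (sym (toℕ-fromℕ< (m%n<n (power l r i) (suc l))))
              (sameOrbit-trans (proj₂ (meets-some-power l r (rep-live i)))
                (reduce-power (suc l) r (power l r i)))

        -- If g^l k (0 < l) were on the f-orbit of k, every f-orbit would contain one
        -- of k, g k, …, g^(l-1) k, so there would be at most l < α of them.
        no-early-return : ∀ l → 0 ℕ.< l → l ℕ.< α → ¬ SameOrbitOf f k (iter g l k)
        no-early-return (suc l) _ l<α r with pigeonhole l<α (class-mod l r)
        ... | i₁ , i₂ , i₁<i₂ , same =
          rep-distinct i₁ i₂ (<⇒≢ i₁<i₂)
            (sameOrbit-trans (rep-meets-class-mod l r i₁)
              (subst (λ c → SameOrbitOf f (iter g (toℕ c) k) (rep i₂)) (sym same)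
                (sameOrbit-sym (rep-meets-class-mod l r i₂))))

        private
          class : Fin (suc α) → Fin α
          class j = proj₁ (cover (iter g (toℕ j) k) (g-power (toℕ j)))

          in-class : ∀ j → SameOrbitOf f (iter g (toℕ j) k) (rep (class j))
          in-class j = proj₂ (cover (iter g (toℕ j) k) (g-power (toℕ j)))

        -- Among k, g k, …, g^α k two share an f-orbit, by pigeonhole.
        returns-after-orbit-count : SameOrbitOf f k (iter g α k)
        returns-after-orbit-count with pigeonhole (n<1+n α) class
        ... | j₁ , j₂ , j₁<j₂ , same = subst (λ t → SameOrbitOf f k (iter g t k)) r≡α k~gʳk
          where
            r = toℕ j₂ ∸ toℕ j₁

            k~gʳk : SameOrbitOf f k (iter g r k)
            k~gʳk = iter-g-sameOrbit⁻ (toℕ j₁) lk (g-power r)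
              (subst (SameOrbitOf f (iter g (toℕ j₁) k))
                (iter-split g (<⇒≤ j₁<j₂) k)
                (sameOrbit-trans (in-class j₁)
                  (subst (λ c → SameOrbitOf f (rep c) _) (sym same) (sameOrbit-sym (in-class j₂)))))

            r≡α : r ≡ α
            r≡α = ℕ.≤-antisym (ℕ.≤-trans (m∸n≤m (toℕ j₂) (toℕ j₁)) (≤-pred (toℕ<n j₂)))
                    (ℕ.≮⇒≥ λ r<α → no-early-return r (m<n⇒0<n∸m j₁<j₂) r<α k~gʳk)

      -- g increases positions, so g^α k cannot lie behind k on its f-orbit.
      forward-in-f-orbit : ∀ α → SameOrbitOf f k (iter g (suc α) k) → ∃ λ b → iter g (suc α) k ≡ iter f b k
      forward-in-f-orbit α (i , j , e) with ≤-total j i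
      ... | inj₁ j≤i = i ∸ j , sym (iter-injectiveOn f-live f-inj j _ _
                         (iter-invariant f-live (i ∸ j) k lk) (g-power (suc α))
                         (trans (sym (iter-split f j≤i k)) e))
      ... | inj₂ i≤j = ⊥-elim (<-irrefl refl (<-≤-trans (iter-inflationary g-infl α k) gᵅk≤k))
        where
          gᵅk = iter g (suc α) k

          k-returns : k ≡ iter f (j ∸ i) gᵅk
          k-returns = iter-injectiveOn f-live f-inj i _ _ lk
            (iter-invariant f-live (j ∸ i) _ (g-power (suc α)))
            (trans e (iter-split f i≤j gᵅk))

          gᵅk≤k : gᵅk ≤ k
          gᵅk≤k = subst (gᵅk ≤_) (sym k-returns) (iter-monotone f-infl {0} {j ∸ i} gᵅk z≤n)

      g-power-in-f-orbit : ∀ {α} → HasOrbits Live f α → ∃ λ b → iter g α k ≡ iter f b k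
      g-power-in-f-orbit {zero}  _      = 0 , refl
      g-power-in-f-orbit {suc α} orbits = forward-in-f-orbit α (returns-after-orbit-count orbits)

  module CommutingPair
    (Live : ℤ → Set) {f g : ℤ → ℤ}
    (f-live : Invariant Live f) (g-live : Invariant Live g)
    (f-inj : InjectiveOn Live f) (g-inj : InjectiveOn Live g)
    (fg-comm : CommuteOn Live f g) (f-infl : Inflationary f) (g-infl : Inflationary g)
    (grid : ∀ {u v} → Live u → Live v → GridMeet f g u v)
    where

    module FG = CommutingMaps Live f-live g-live f-inj g-inj fg-comm f-infl g-infl grid
    module GF = CommutingMaps Live g-live f-live g-inj f-inj (λ a pa → sym (fg-comm a pa)) g-infl f-infl
                  (λ lu lv → GridMeeting.gridMeet-swap f-live g-live fg-comm lu lv (grid lu lv))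

    module _ {α β k} (f-orbits : HasOrbits Live f α) (g-orbits : HasOrbits Live g β) (lk : Live k) where

      private
        -- f^b k = g^α k is on the g-orbit of k, so b = 0 or b ≥ β; and b = 0 is
        -- excluded as g^α k > k.
        at-least : ∀ {α β} {f g : ℤ → ℤ} → Inflationary g → NonZero α →
                   (∀ l → 0 ℕ.< l → l ℕ.< β → ¬ SameOrbitOf g k (iter f l k)) →
                   ∀ b → iter g α k ≡ iter f b k → β ℕ.≤ b
        at-least {suc α} g-infl _ early zero e = ⊥-elim (<-irrefl (sym e) (iter-inflationary g-infl α k))
        at-least {α} g-infl _ early (suc b) e =
          ℕ.≮⇒≥ (λ b<β → early (suc b) (s≤s z≤n) b<β (α , 0 , e))

      snake-meets-cosnake : iter f β k ≡ iter g α k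
      snake-meets-cosnake with b , gᵅ≡fᵇ ← FG.g-power-in-f-orbit lk f-orbits
                             | a , fᵝ≡gᵃ ← GF.g-power-in-f-orbit lk g-orbits =
        ≤-antisym (≤-trans (iter-monotone f-infl k β≤b) (≤-reflexive (sym gᵅ≡fᵇ)))
                  (≤-trans (iter-monotone g-infl k α≤a) (≤-reflexive (sym fᵝ≡gᵃ)))
        where
          β≤b = at-least g-infl (orbitCount-pos f-orbits lk) (GF.no-early-return lk g-orbits) b gᵅ≡fᵇ
          α≤a = at-least f-infl (orbitCount-pos g-orbits lk) (FG.no-early-return lk f-orbits) a fᵝ≡gᵃ

open OrbitCounting

module PeriodicWords where

  open import Defs using (iter; rot1; LengthOverPeriod; stepWord)
  open import Data.Nat using (ℕ; zero; suc; _+_; _*_; _<_; _%_; _/_; NonZero; s≤s)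
  open import Data.Nat.Properties using (+-comm; +-assoc; +-suc; +-identityʳ; *-comm; *-assoc)
  open import Data.Nat.DivMod using (m≡m%n+[m/n]*n; m%n<n)
  open import Data.Nat.Divisibility using (_∣_; divides)
  open import Data.Integer as ℤ using (ℤ; +_; _-_)
  import Data.Integer.Properties as ℤ
  open import Data.Integer.Tactic.RingSolver using (solve-∀)
  open import Data.List using (_∷_; _∷ʳ_; applyUpTo; length)
  open import Data.List.Properties using (∷-injective; length-applyUpTo)
  open import Data.Product using (∃; _×_; _,_; proj₁; proj₂)
  open import Function using (_∘_)
  open import Relation.Binary.PropositionalEquality
  open ≡-Reasoning

  module _ {A : Set} where

    applyUpTo-cong : ∀ {u v : ℕ → A} → (∀ j → u j ≡ v j) → ∀ n → applyUpTo u n ≡ applyUpTo v n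
    applyUpTo-cong u≗v zero    = refl
    applyUpTo-cong u≗v (suc n) = cong₂ _∷_ (u≗v 0) (applyUpTo-cong (u≗v ∘ suc) n)

    applyUpTo-∷ʳ : ∀ (w : ℕ → A) n → applyUpTo w (suc n) ≡ applyUpTo w n ∷ʳ w n
    applyUpTo-∷ʳ w zero    = refl
    applyUpTo-∷ʳ w (suc n) = cong (w 0 ∷_) (applyUpTo-∷ʳ (w ∘ suc) n)

    applyUpTo-injective : ∀ {u v : ℕ → A} n → applyUpTo u n ≡ applyUpTo v n → ∀ j → j < n → u j ≡ v j
    applyUpTo-injective (suc n) e zero    _       = proj₁ (∷-injective e)
    applyUpTo-injective (suc n) e (suc j) (s≤s j<n) = applyUpTo-injective n (proj₂ (∷-injective e)) j j<n

    Periodic : (ℕ → A) → ℕ → Set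
    Periodic w p = ∀ j → w (p + j) ≡ w j

    periodic-* : ∀ {w p} → Periodic w p → ∀ q → Periodic w (q * p)
    periodic-* per zero    j = refl
    periodic-* {w} {p} per (suc q) j = trans (cong w (+-assoc p (q * p) j)) (trans (per _) (periodic-* per q j))

    periodic-mod : ∀ {w L} .{{_ : NonZero L}} → Periodic w L → ∀ j → w j ≡ w (j % L)
    periodic-mod {w} {L} per j = begin
      w j                   ≡⟨ cong w (m≡m%n+[m/n]*n j L) ⟩
      w (j % L + j / L * L) ≡⟨ cong w (+-comm (j % L) _) ⟩
      w (j / L * L + j % L) ≡⟨ periodic-* per (j / L) (j % L) ⟩
      w (j % L)             ∎

    rot1-applyUpTo : ∀ (w : ℕ → A) n → w (suc n) ≡ w 0 →
                     rot1 (applyUpTo w (suc n)) ≡ applyUpTo (w ∘ suc) (suc n)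
    rot1-applyUpTo w n wrap = begin
      applyUpTo (w ∘ suc) n ∷ʳ w 0       ≡⟨ cong (applyUpTo (w ∘ suc) n ∷ʳ_) (sym wrap) ⟩
      applyUpTo (w ∘ suc) n ∷ʳ w (suc n) ≡⟨ applyUpTo-∷ʳ (w ∘ suc) n ⟨
      applyUpTo (w ∘ suc) (suc n)        ∎

    rotate-applyUpTo : ∀ {w} L → Periodic w L →
                       ∀ p → iter rot1 p (applyUpTo w L) ≡ applyUpTo (λ j → w (p + j)) L
    rotate-applyUpTo zero    per zero    = refl
    rotate-applyUpTo zero    per (suc p) = cong rot1 (rotate-applyUpTo zero per p)
    rotate-applyUpTo (suc n) per zero    = refl
    rotate-applyUpTo {w} (suc n) per (suc p) = begin
      rot1 (iter rot1 p (applyUpTo w (suc n)))   ≡⟨ cong rot1 (rotate-applyUpTo (suc n) per p) ⟩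
      rot1 (applyUpTo (λ j → w (p + j)) (suc n)) ≡⟨ rot1-applyUpTo (λ j → w (p + j)) n wrap ⟩
      applyUpTo (λ j → w (p + suc j)) (suc n)    ≡⟨ applyUpTo-cong (λ j → cong w (+-suc p j)) (suc n) ⟩
      applyUpTo (λ j → w (suc p + j)) (suc n)    ∎
      where
        wrap : w (p + suc n) ≡ w (p + 0)
        wrap = trans (cong w (+-comm p (suc n))) (trans (per p) (cong w (sym (+-identityʳ p))))

    rotation-period : ∀ {w} L .{{_ : NonZero L}} → Periodic w L →
                      ∀ p → iter rot1 p (applyUpTo w L) ≡ applyUpTo w L → Periodic w p
    rotation-period {w} L per p rot j = begin
      w (p + j)               ≡⟨ cong (λ t → w (p + t)) (m≡m%n+[m/n]*n j L) ⟩
      w (p + (r + q * L))     ≡⟨ cong w (trans (sym (+-assoc p r (q * L))) (+-comm (p + r) (q * L))) ⟩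
      w (q * L + (p + r))     ≡⟨ periodic-* per q (p + r) ⟩
      w (p + r)               ≡⟨ applyUpTo-injective L (trans (sym (rotate-applyUpTo L per p)) rot) r (m%n<n j L) ⟩
      w r                     ≡⟨ periodic-mod per j ⟨
      w j                     ∎
      where
        r = j % L
        q = j / L

    -- d = L / p for the least rotation period p, so i ∣ d makes (d / i) p a period.
    divisor-period : ∀ {w} L .{{_ : NonZero L}} → Periodic w L →
                     ∀ {d} → LengthOverPeriod (applyUpTo w L) d →
                     ∀ {i} → i ∣ d → ∃ λ m → L ≡ i * m × Periodic w m
    divisor-period {w} L per {d} (p , (_ , rot , _) , len) {i} (divides q d≡q*i) =
      q * p , L≡i*m , periodic-* (rotation-period L per p rot) q
      where
        L≡i*m : L ≡ i * (q * p)
        L≡i*m = begin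
          L                       ≡⟨ length-applyUpTo w L ⟨
          length (applyUpTo w L)  ≡⟨ len ⟩
          d * p                   ≡⟨ cong (_* p) d≡q*i ⟩
          q * i * p               ≡⟨ cong (_* p) (*-comm q i) ⟩
          i * q * p               ≡⟨ *-assoc i q p ⟩
          i * (q * p)             ∎

  module _ (x : ℕ → ℤ) {m : ℕ} (per : Periodic (λ j → x (suc j) - x j) m) where

    shifted-difference : ∀ j → x (m + j) - x j ≡ x m - x 0
    shifted-difference zero    = cong (λ t → x t - x 0) (+-identityʳ m)
    shifted-difference (suc j) = begin
      x (m + suc j) - x (suc j)
        ≡⟨ cong (λ t → x t - x (suc j)) (+-suc m j) ⟩
      x (suc (m + j)) - x (suc j)
        ≡⟨ regroup (x (suc (m + j))) (x (m + j)) (x (suc j)) (x j) ⟩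
      (x (suc (m + j)) - x (m + j)) ℤ.+ (x (m + j) - x j) - (x (suc j) - x j)
        ≡⟨ cong₂ (λ a b → a ℤ.+ b - (x (suc j) - x j)) (per j) (shifted-difference j) ⟩
      (x (suc j) - x j) ℤ.+ (x m - x 0) - (x (suc j) - x j)
        ≡⟨ cancel (x (suc j) - x j) (x m - x 0) ⟩
      x m - x 0 ∎
      where
        regroup : ∀ a b c d → a - c ≡ (a - b) ℤ.+ (b - d) - (c - d)
        regroup = solve-∀
        cancel : ∀ a b → a ℤ.+ b - a ≡ b
        cancel = solve-∀

    displacement-* : ∀ t → x (t * m) - x 0 ≡ + t ℤ.* (x m - x 0)
    displacement-* zero    = ℤ.+-inverseʳ (x 0)
    displacement-* (suc t) = begin
      x (m + t * m) - x 0
        ≡⟨ split (x (m + t * m)) (x (t * m)) (x 0) ⟩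
      (x (m + t * m) - x (t * m)) ℤ.+ (x (t * m) - x 0)
        ≡⟨ cong₂ ℤ._+_ (shifted-difference (t * m)) (displacement-* t) ⟩
      (x m - x 0) ℤ.+ + t ℤ.* (x m - x 0)
        ≡⟨ collect (+ t) (x m - x 0) ⟩
      + suc t ℤ.* (x m - x 0) ∎
      where
        split : ∀ a b c → a - c ≡ (a - b) ℤ.+ (b - c)
        split = solve-∀
        collect : ∀ t y → y ℤ.+ t ℤ.* y ≡ (+ 1 ℤ.+ t) ℤ.* y
        collect = solve-∀

  stepWord-applyUpTo : ∀ n .{{_ : NonZero n}} {T : Set} (f : ℤ → ℤ) (ty : ℤ → T) k m →
                       stepWord n f ty k m ≡ applyUpTo (λ j → ty (iter f j k)) m
  stepWord-applyUpTo n f ty k zero    = refl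
  stepWord-applyUpTo n f ty k (suc m) = cong (ty k ∷_) (trans (stepWord-applyUpTo n f ty (f k) m)
    (applyUpTo-cong (λ j → cong ty (iter-suc f j k)) m))

  module _ {T : Set} (f : ℤ → ℤ) (ty : ℤ → T) (δ : T → ℤ)
           (step : ∀ y → f y ≡ y ℤ.+ δ (ty y)) (k : ℤ) where

    divisor-displacement : ∀ L .{{_ : NonZero L}} → Periodic (λ j → ty (iter f j k)) L →
                           ∀ {d} → LengthOverPeriod (applyUpTo (λ j → ty (iter f j k)) L) d →
                           ∀ {i} → i ∣ d → ∃ λ m → L ≡ i * m × iter f L k - k ≡ + i ℤ.* (iter f m k - k)
    divisor-displacement L per word {i} i∣d with m , L≡i*m , per-m ← divisor-period L per word i∣d =
      m , L≡i*m , trans (cong (λ t → iter f t k - k) L≡i*m) (displacement-* (λ j → iter f j k) increments i)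
      where
        increment : ∀ j → iter f (suc j) k - iter f j k ≡ δ (ty (iter f j k))
        increment j = trans (cong (_- iter f j k) (step (iter f j k))) (cancel (iter f j k) (δ (ty (iter f j k))))
          where
            cancel : ∀ a b → a ℤ.+ b - a ≡ b
            cancel = solve-∀

        increments : Periodic (λ j → iter f (suc j) k - iter f j k) m
        increments j = trans (increment (m + j)) (trans (cong δ (per-m j)) (sym (increment j)))

open PeriodicWords

module TapeRows where

  open import Defs using (SType; E; D; CType; S; L)
  open import Data.Bool using (Bool; true; false; not; _∨_; if_then_else_)
  open import Data.Bool.Properties using (∨-zeroʳ; ∨-identityʳ; not-injective)
  open import Data.Nat using (ℕ; s≤s; z≤n)
  import Data.Nat.Properties as ℕ
  open import Data.Nat.Properties using (m≤n⇒∃[o]m+o≡n; m≤n+m)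
  open import Data.Integer using (ℤ; +_; -[1+_]; _+_; _-_; _*_; -_; _<_; +<+)
  import Data.Integer.Properties as ℤ
  open import Data.Integer.Tactic.RingSolver using (solve-∀)
  open import Data.Product using (_,_)
  open import Data.Empty using (⊥; ⊥-elim)
  open import Relation.Binary.PropositionalEquality
  open ≡-Reasoning

  bool-cases : ∀ {P : Set} (x : Bool) → (x ≡ true → P) → (x ≡ false → P) → P
  bool-cases true  t f = t refl
  bool-cases false t f = f refl

  -- A tape X : ℤ → Bool laid out in rows of length n: position v + (a n + b) is
  -- row a, column b relative to v.
  module Tape (n : ℕ) (X : ℤ → Bool) where

    N : ℤ
    N = + n

    at : ℤ → ℤ → ℤ → ℤ
    at v a b = v + (a * N + b)

    Y : ℤ → ℤ → ℤ → Bool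
    Y v a b = X (at v a b)

    Live : ℤ → Set
    Live v = X v ≡ true

    at-at : ∀ v a b a′ b′ → at (at v a b) a′ b′ ≡ at v (a + a′) (b + b′)
    at-at v a b a′ b′ = shift v a b a′ b′ N
      where
        shift : ∀ v a b a′ b′ N → v + (a * N + b) + (a′ * N + b′) ≡ v + ((a + a′) * N + (b + b′))
        shift = solve-∀

    Y-at : ∀ v a b a′ b′ → Y (at v a b) a′ b′ ≡ Y v (a + a′) (b + b′)
    Y-at v a b a′ b′ = cong X (at-at v a b a′ b′)

    at-cancel : ∀ {u v} a b a′ b′ → at u a b ≡ at v a′ b′ → u ≡ at v (a′ - a) (b′ - b)
    at-cancel {u} {v} a b a′ b′ e =
      trans (back u a b N) (trans (cong (λ w → w - (a * N + b)) e) (regroup v a b a′ b′ N))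
      where
        back : ∀ u a b N → u ≡ u + (a * N + b) - (a * N + b)
        back = solve-∀
        regroup : ∀ v a b a′ b′ N → v + (a′ * N + b′) - (a * N + b) ≡ v + ((a′ - a) * N + (b′ - b))
        regroup = solve-∀

    at-injective : ∀ {u v} a b → at u a b ≡ at v a b → u ≡ v
    at-injective {u} {v} a b e = trans (back u a b N) (trans (cong (λ w → w - (a * N + b)) e) (sym (back v a b N)))
      where
        back : ∀ u a b N → u ≡ u + (a * N + b) - (a * N + b)
        back = solve-∀

    s : ℤ → ℤ
    s k = if X (k + + 2) then k + + 2 else k + + n + + 1

    c : ℤ → ℤ
    c k = if X (k + + 2 * + n - + 1) then k + + 2 * + n - + 1 else k + + 2 * + n - + 2

    s-type : ℤ → SType
    s-type k = if X (k + + 2) then E else D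

    c-type : ℤ → CType
    c-type k = if X (k + + 2 * + n - + 1) then S else L

    σ : SType → ℤ
    σ E = + 2
    σ D = + n + + 1

    γ : CType → ℤ
    γ S = + 2 * + n - + 1
    γ L = + 2 * + n - + 2

    s-displacement : ∀ y → s y ≡ y + σ (s-type y)
    s-displacement y with X (y + + 2)
    ... | true  = refl
    ... | false = ℤ.+-assoc y (+ n) (+ 1)

    c-displacement : ∀ y → c y ≡ y + γ (c-type y)
    c-displacement y with X (y + + 2 * + n - + 1)
    ... | true  = ℤ.+-assoc y (+ 2 * N) (- + 1)
    ... | false = ℤ.+-assoc y (+ 2 * N) (- + 2)

    s-E : ∀ {v} → Y v (+ 0) (+ 2) ≡ true → s v ≡ at v (+ 0) (+ 2)
    s-E e rewrite e = refl

    s-D : ∀ {v} → Y v (+ 0) (+ 2) ≡ false → s v ≡ at v (+ 1) (+ 1)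
    s-D {v} e rewrite e = trans (ℤ.+-assoc v N (+ 1)) (cong (λ t → v + (t + + 1)) (sym (ℤ.*-identityˡ N)))

    c-bit : ∀ v → X (v + + 2 * N - + 1) ≡ Y v (+ 2) -[1+ 0 ]
    c-bit v = cong X (ℤ.+-assoc v (+ 2 * N) (- + 1))

    c-S : ∀ {v} → Y v (+ 2) -[1+ 0 ] ≡ true → c v ≡ at v (+ 2) -[1+ 0 ]
    c-S {v} e rewrite c-bit v | e = ℤ.+-assoc v (+ 2 * N) (- + 1)

    c-L : ∀ {v} → Y v (+ 2) -[1+ 0 ] ≡ false → c v ≡ at v (+ 2) -[1+ 1 ]
    c-L {v} e rewrite c-bit v | e = ℤ.+-assoc v (+ 2 * N) (- + 2)

    Recurrence : Set
    Recurrence = ∀ k → X k ≡ not (X (k - + 1) ∨ X (k - N) ∨ X (k - N + + 1))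

    -- Read in rows, the recurrence says a cell is on exactly when its left,
    -- upper and upper-right neighbours are all off.
    module Automaton (rec : Recurrence) where

      rec-at : ∀ v a b → Y v a b ≡ not (Y v a (b - + 1) ∨ Y v (a - + 1) b ∨ Y v (a - + 1) (b + + 1))
      rec-at v a b = trans (rec (at v a b)) (cong₂ (λ p q → not (X p ∨ q))
        (left v a b N) (cong₂ (λ p q → X p ∨ X q) (up v a b N) (upright v a b N)))
        where
          left : ∀ v a b N → v + (a * N + b) - + 1 ≡ v + (a * N + (b - + 1))
          left = solve-∀
          up : ∀ v a b N → v + (a * N + b) - N ≡ v + ((a - + 1) * N + b)
          up = solve-∀
          upright : ∀ v a b N → v + (a * N + b) - N + + 1 ≡ v + ((a - + 1) * N + (b + + 1))
          upright = solve-∀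

      on-if-all-off : ∀ v a b → Y v a (b - + 1) ≡ false → Y v (a - + 1) b ≡ false →
                      Y v (a - + 1) (b + + 1) ≡ false → Y v a b ≡ true
      on-if-all-off v a b l u r rewrite rec-at v a b | l | u | r = refl

      off-if-left-on : ∀ v a b → Y v a (b - + 1) ≡ true → Y v a b ≡ false
      off-if-left-on v a b l rewrite rec-at v a b | l = refl

      off-if-up-on : ∀ v a b → Y v (a - + 1) b ≡ true → Y v a b ≡ false
      off-if-up-on v a b u rewrite rec-at v a b | u | ∨-zeroʳ (Y v a (b - + 1)) = refl

      off-if-upright-on : ∀ v a b → Y v (a - + 1) (b + + 1) ≡ true → Y v a b ≡ false
      off-if-upright-on v a b r
        rewrite rec-at v a b | r | ∨-zeroʳ (Y v (a - + 1) b) | ∨-zeroʳ (Y v a (b - + 1)) = refl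

      not-upright : ∀ v a b → Y v a (b - + 1) ≡ false → Y v (a - + 1) b ≡ false →
                    Y v a b ≡ not (Y v (a - + 1) (b + + 1))
      not-upright v a b l u rewrite rec-at v a b | l | u = refl

      not-left : ∀ v a b → Y v (a - + 1) b ≡ false → Y v (a - + 1) (b + + 1) ≡ false →
                 Y v a b ≡ not (Y v a (b - + 1))
      not-left v a b u r rewrite rec-at v a b | u | r | ∨-identityʳ (Y v a (b - + 1)) = refl

      module Neighbourhood {v : ℤ} (lv : Live v) where

        on₀₀ : Y v (+ 0) (+ 0) ≡ true
        on₀₀ = trans (cong X (ℤ.+-identityʳ v)) lv

        off₀₁ : Y v (+ 0) (+ 1) ≡ false
        off₀₁ = off-if-left-on v (+ 0) (+ 1) on₀₀

        off₁₀ : Y v (+ 1) (+ 0) ≡ false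
        off₁₀ = off-if-up-on v (+ 1) (+ 0) on₀₀

        off₁₋₁ : Y v (+ 1) -[1+ 0 ] ≡ false
        off₁₋₁ = off-if-upright-on v (+ 1) -[1+ 0 ] on₀₀

        off₀₋₁ : Y v (+ 0) -[1+ 0 ] ≡ false
        off₀₋₁ with Y v (+ 0) -[1+ 0 ] in e
        ... | false = refl
        ... | true with () ← trans (sym on₀₀) (off-if-left-on v (+ 0) (+ 0) e)

        Y₁₁ : Y v (+ 1) (+ 1) ≡ not (Y v (+ 0) (+ 2))
        Y₁₁ = not-upright v (+ 1) (+ 1) off₁₀ off₀₁

        Y₂₋₁ : Y v (+ 2) -[1+ 0 ] ≡ not (Y v (+ 2) -[1+ 1 ])
        Y₂₋₁ = not-left v (+ 2) -[1+ 0 ] off₁₋₁ off₁₀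

        off₁₁ : Y v (+ 0) (+ 2) ≡ true → Y v (+ 1) (+ 1) ≡ false
        off₁₁ a = trans Y₁₁ (cong not a)

        on₁₁ : Y v (+ 0) (+ 2) ≡ false → Y v (+ 1) (+ 1) ≡ true
        on₁₁ a = trans Y₁₁ (cong not a)

        on₂₋₂ : Y v (+ 2) -[1+ 0 ] ≡ false → Y v (+ 2) -[1+ 1 ] ≡ true
        on₂₋₂ b = not-injective (trans (sym Y₂₋₁) b)

        on₂₁ : Y v (+ 0) (+ 2) ≡ true → Y v (+ 2) -[1+ 0 ] ≡ true → Y v (+ 2) (+ 1) ≡ true
        on₂₁ a b = on-if-all-off v (+ 2) (+ 1) (off-if-left-on v (+ 2) (+ 0) b) (off₁₁ a)
                     (off-if-up-on v (+ 1) (+ 2) a)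

        on₂₀ : Y v (+ 0) (+ 2) ≡ true → Y v (+ 2) -[1+ 0 ] ≡ false → Y v (+ 2) (+ 0) ≡ true
        on₂₀ a b = on-if-all-off v (+ 2) (+ 0) b off₁₀ (off₁₁ a)

        -- With a = Y v 0 2 (the bit choosing the s-step) and b = Y v 2 -1 (the bit
        -- choosing the c-step), each step lands where the other map reads the same bit.
        c-S-table : Y v (+ 2) -[1+ 0 ] ≡ true → Y v (+ 2) (+ 1) ≡ Y v (+ 0) (+ 2)
        c-S-table b with Y v (+ 0) (+ 2) in a
        ... | true  = on₂₁ a b
        ... | false = off-if-up-on v (+ 2) (+ 1) (on₁₁ a)

        c-L-table : Y v (+ 2) -[1+ 0 ] ≡ false → Y v (+ 2) (+ 0) ≡ Y v (+ 0) (+ 2)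
        c-L-table b with Y v (+ 0) (+ 2) in a
        ... | true  = on₂₀ a b
        ... | false = off-if-upright-on v (+ 2) (+ 0) (on₁₁ a)

        s-E-table : Y v (+ 0) (+ 2) ≡ true → Y v (+ 2) (+ 1) ≡ Y v (+ 2) -[1+ 0 ]
        s-E-table a with Y v (+ 2) -[1+ 0 ] in b
        ... | true  = on₂₁ a b
        ... | false = off-if-left-on v (+ 2) (+ 1) (on₂₀ a b)

        s-D-table : Y v (+ 0) (+ 2) ≡ false → Y v (+ 3) (+ 0) ≡ Y v (+ 2) -[1+ 0 ]
        s-D-table a with Y v (+ 2) -[1+ 0 ] in b
        ... | true  = on-if-all-off v (+ 3) (+ 0) (off-if-up-on v (+ 3) -[1+ 0 ] b)
                        (off-if-left-on v (+ 2) (+ 0) b) (off-if-up-on v (+ 2) (+ 1) (on₁₁ a))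
        ... | false = off-if-left-on v (+ 3) (+ 0)
                        (on-if-all-off v (+ 3) -[1+ 0 ] (off-if-up-on v (+ 3) -[1+ 1 ] (on₂₋₂ b)) b
                          (off-if-upright-on v (+ 2) (+ 0) (on₁₁ a)))

      open Neighbourhood

      s-live : Invariant Live s
      s-live v lv = bool-cases (Y v (+ 0) (+ 2))
        (λ a → subst Live (sym (s-E {v} a)) a)
        (λ a → subst Live (sym (s-D {v} a)) (on₁₁ lv a))

      c-live : Invariant Live c
      c-live v lv = bool-cases (Y v (+ 2) -[1+ 0 ])
        (λ b → subst Live (sym (c-S {v} b)) b)
        (λ b → subst Live (sym (c-L {v} b)) (on₂₋₂ lv b))

      s-type-c : ∀ v → Live v → s-type (c v) ≡ s-type v
      s-type-c v lv = cong (λ x → if x then E else D) (bool-cases (Y v (+ 2) -[1+ 0 ])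
        (λ b → trans (cong (λ u → Y u (+ 0) (+ 2)) (c-S {v} b))
                     (trans (Y-at v (+ 2) -[1+ 0 ] (+ 0) (+ 2)) (c-S-table lv b)))
        (λ b → trans (cong (λ u → Y u (+ 0) (+ 2)) (c-L {v} b))
                     (trans (Y-at v (+ 2) -[1+ 1 ] (+ 0) (+ 2)) (c-L-table lv b))))

      c-type-s : ∀ v → Live v → c-type (s v) ≡ c-type v
      c-type-s v lv = trans (c-type-bit (s v)) (trans (cong (λ x → if x then S else L) same-bit) (sym (c-type-bit v)))
        where
          c-type-bit : ∀ u → c-type u ≡ (if Y u (+ 2) -[1+ 0 ] then S else L)
          c-type-bit u = cong (λ x → if x then S else L) (c-bit u)

          same-bit : Y (s v) (+ 2) -[1+ 0 ] ≡ Y v (+ 2) -[1+ 0 ]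
          same-bit = bool-cases (Y v (+ 0) (+ 2))
            (λ a → trans (cong (λ u → Y u (+ 2) -[1+ 0 ]) (s-E {v} a))
                         (trans (Y-at v (+ 0) (+ 2) (+ 2) -[1+ 0 ]) (s-E-table lv a)))
            (λ a → trans (cong (λ u → Y u (+ 2) -[1+ 0 ]) (s-D {v} a))
                         (trans (Y-at v (+ 1) (+ 1) (+ 2) -[1+ 0 ]) (s-D-table lv a)))

      -- Both composites take the same two steps, in either order.
      s-c-commute : CommuteOn Live s c
      s-c-commute v lv = begin
        s (c v)                          ≡⟨ s-displacement (c v) ⟩
        c v + σ (s-type (c v))           ≡⟨ cong₂ (λ w t → w + σ t) (c-displacement v) (s-type-c v lv) ⟩
        v + γ (c-type v) + σ (s-type v)  ≡⟨ swap v (γ (c-type v)) (σ (s-type v)) ⟩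
        v + σ (s-type v) + γ (c-type v)  ≡⟨ cong₂ (λ w t → w + γ t) (s-displacement v) (c-type-s v lv) ⟨
        s v + γ (c-type (s v))           ≡⟨ c-displacement (s v) ⟨
        c (s v)                          ∎
        where
          swap : ∀ v x y → v + x + y ≡ v + y + x
          swap = solve-∀

      private
        on-off : ∀ {w} → X w ≡ true → X w ≡ false → ⊥
        on-off t f with () ← trans (sym t) f

      s-steps-differ : ∀ {u v} → Live u → Live v →
                       Y u (+ 0) (+ 2) ≡ true → Y v (+ 0) (+ 2) ≡ false → s u ≢ s v
      s-steps-differ {u} {v} lu lv a b e =
        on-off (subst Live (at-cancel {u} {v} (+ 0) (+ 2) (+ 1) (+ 1) (trans (sym (s-E {u} a)) (trans e (s-D {v} b)))) lu)
          (off₁₋₁ lv)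

      c-steps-differ : ∀ {u v} → Live u → Live v →
                       Y u (+ 2) -[1+ 0 ] ≡ true → Y v (+ 2) -[1+ 0 ] ≡ false → c u ≢ c v
      c-steps-differ {u} {v} lu lv a b e =
        on-off (subst Live (at-cancel {u} {v} (+ 2) -[1+ 0 ] (+ 2) -[1+ 1 ]
                             (trans (sym (c-S {u} a)) (trans e (c-L {v} b)))) lu)
          (off₀₋₁ lv)

      s-injective : InjectiveOn Live s
      s-injective u v lu lv e = bool-cases (Y u (+ 0) (+ 2))
        (λ a → bool-cases (Y v (+ 0) (+ 2))
          (λ b → at-injective (+ 0) (+ 2) (trans (sym (s-E {u} a)) (trans e (s-E {v} b))))
          (λ b → ⊥-elim (s-steps-differ lu lv a b e)))
        (λ a → bool-cases (Y v (+ 0) (+ 2))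
          (λ b → ⊥-elim (s-steps-differ lv lu b a (sym e)))
          (λ b → at-injective (+ 1) (+ 1) (trans (sym (s-D {u} a)) (trans e (s-D {v} b)))))

      c-injective : InjectiveOn Live c
      c-injective u v lu lv e = bool-cases (Y u (+ 2) -[1+ 0 ])
        (λ a → bool-cases (Y v (+ 2) -[1+ 0 ])
          (λ b → at-injective (+ 2) -[1+ 0 ] (trans (sym (c-S {u} a)) (trans e (c-S {v} b))))
          (λ b → ⊥-elim (c-steps-differ lu lv a b e)))
        (λ a → bool-cases (Y v (+ 2) -[1+ 0 ])
          (λ b → ⊥-elim (c-steps-differ lv lu b a (sym e)))
          (λ b → at-injective (+ 2) -[1+ 1 ] (trans (sym (c-L {u} a)) (trans e (c-L {v} b)))))

    private
      <-+-pos : ∀ y {p} → + 0 < p → y < y + p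
      <-+-pos y 0<p = subst (_< y + _) (ℤ.+-identityʳ y) (ℤ.+-monoʳ-< y 0<p)

    s-inflationary : Inflationary s
    s-inflationary y = subst (y <_) (sym (s-displacement y)) (<-+-pos y (σ-pos (s-type y)))
      where
        σ-pos : ∀ t → + 0 < σ t
        σ-pos E = +<+ (s≤s z≤n)
        σ-pos D = +<+ (m≤n+m 1 n)

    c-inflationary : 2 ℕ.≤ n → Inflationary c
    c-inflationary 2≤n y = subst (y <_) (sym (c-displacement y)) (<-+-pos y (γ-pos 2≤n (c-type y)))
      where
        γ-pos : 2 ℕ.≤ n → ∀ t → + 0 < γ t
        γ-pos 2≤n t with m≤n⇒∃[o]m+o≡n 2≤n
        γ-pos 2≤n S | o , refl = +<+ (s≤s z≤n)
        γ-pos 2≤n L | o , refl = +<+ (ℕ.≤-trans (s≤s z≤n) (m≤n+m _ o))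

open TapeRows

module Connectivity (n : ℕ) (X : ℤ → Bool) (rec : Tape.Recurrence n X) where

  open import Defs using (iter)
  open import Data.Bool using (Bool; true; false)
  open import Data.Nat using (ℕ; zero; suc; s≤s; z≤n)
  open import Data.Nat.Properties as ℕ using (m<1+n⇒m<n∨m≡n; +-suc; +-identityʳ)
  open import Data.Integer using (ℤ; +_; -[1+_]; _+_; _-_; ∣_∣)
  open import Data.Integer as ℤ using ()
  import Data.Integer.Properties as ℤ
  open import Data.Integer.Tactic.RingSolver using (solve-∀)
  open import Data.Product using (∃; _,_)
  open import Data.Sum using (inj₁; inj₂)
  open import Relation.Binary.PropositionalEquality
  open ≡-Reasoning

  open Tape n X
  open Automaton rec
  open Neighbourhood
  open GridMeeting s-live c-live s-c-commute

  -- The row above w is off from w's column to column r - 1 and on at column r ≥ 2.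
  -- The snake of w moves right along w's row by E-steps until it is two or three
  -- columns short of that cell; its next (D-)step lands on the cell's co-successor.
  snake-under-cell : ∀ r {w} → Live w → 2 ℕ.≤ r →
                     (∀ i → i ℕ.< r → Y w -[1+ 0 ] (+ i) ≡ false) → Y w -[1+ 0 ] (+ r) ≡ true →
                     ∃ λ t → c (at w -[1+ 0 ] (+ r)) ≡ iter s t w
  snake-under-cell 1 _ (s≤s ()) _ _
  snake-under-cell 2 {w} lw _ dead on =
    1 , trans (c-S {at w -[1+ 0 ] (+ 2)} (trans (Y-at w -[1+ 0 ] (+ 2) (+ 2) -[1+ 0 ]) s-on))
              (trans (at-at w -[1+ 0 ] (+ 2) (+ 2) -[1+ 0 ]) (sym (s-D {w} Y₀₂-off)))
    where
      Y₀₂-off : Y w (+ 0) (+ 2) ≡ false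
      Y₀₂-off = off-if-up-on w (+ 0) (+ 2) on
      s-on : Y w (+ 1) (+ 1) ≡ true
      s-on = on₁₁ lw Y₀₂-off
  snake-under-cell 3 {w} lw _ dead on =
    1 , trans (c-L {at w -[1+ 0 ] (+ 3)} (trans (Y-at w -[1+ 0 ] (+ 3) (+ 2) -[1+ 0 ])
                 (off-if-left-on w (+ 1) (+ 2) (on₁₁ lw Y₀₂-off))))
              (trans (at-at w -[1+ 0 ] (+ 3) (+ 2) -[1+ 1 ]) (sym (s-D {w} Y₀₂-off)))
    where
      Y₀₂-off : Y w (+ 0) (+ 2) ≡ false
      Y₀₂-off = off-if-upright-on w (+ 0) (+ 2) on
  snake-under-cell (suc (suc (suc (suc r)))) {w} lw _ dead on =
    shift (snake-under-cell (suc (suc r)) {w′} Y₀₂-on (s≤s (s≤s z≤n)) dead′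
             (trans (Y-at w (+ 0) (+ 2) -[1+ 0 ] (+ suc (suc r))) on))
    where
      Y₀₂-on : Y w (+ 0) (+ 2) ≡ true
      Y₀₂-on = on-if-all-off w (+ 0) (+ 2) (off₀₁ lw) (dead 2 (s≤s (s≤s (s≤s z≤n))))
                 (dead 3 (s≤s (s≤s (s≤s (s≤s z≤n)))))

      w′ = at w (+ 0) (+ 2)

      dead′ : ∀ i → i ℕ.< suc (suc r) → Y w′ -[1+ 0 ] (+ i) ≡ false
      dead′ i i<r = trans (Y-at w (+ 0) (+ 2) -[1+ 0 ] (+ i)) (dead (suc (suc i)) (s≤s (s≤s i<r)))

      shift : (∃ λ t → c (at w′ -[1+ 0 ] (+ suc (suc r))) ≡ iter s t w′) →
              ∃ λ t → c (at w -[1+ 0 ] (+ suc (suc (suc (suc r))))) ≡ iter s t w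
      shift (t , e) = suc t , (begin
        c (at w -[1+ 0 ] (+ suc (suc (suc (suc r))))) ≡⟨ cong c (at-at w (+ 0) (+ 2) -[1+ 0 ] (+ suc (suc r))) ⟨
        c (at w′ -[1+ 0 ] (+ suc (suc r)))           ≡⟨ e ⟩
        iter s t w′                                  ≡⟨ cong (iter s t) (s-E {w} Y₀₂-on) ⟨
        iter s t (s w)                               ≡⟨ iter-suc s t w ⟩
        iter s (suc t) w                             ∎)

  next-live-meets : ∀ j {u} → Live u → (∀ i → i ℕ.< j → Y u (+ 0) (+ suc i) ≡ false) →
                    Y u (+ 0) (+ suc j) ≡ true → GridMeet s c u (u + + suc j)
  next-live-meets 0 lu _ on with () ← trans (sym on) (off₀₁ lu)
  next-live-meets 1 {u} lu _ on = 1 , 0 , 0 , 0 , s-E {u} on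
  next-live-meets (suc (suc j)) {u} lu dead on =
    meet (snake-under-cell (suc (suc j)) {s u} (s-live u lu) (s≤s (s≤s z≤n)) dead′
           (trans (cong (λ w → Y w -[1+ 0 ] (+ suc (suc j))) (s-D {u} Y₀₂-off))
             (trans (Y-at u (+ 1) (+ 1) -[1+ 0 ] (+ suc (suc j))) on)))
    where
      Y₀₂-off : Y u (+ 0) (+ 2) ≡ false
      Y₀₂-off = dead 1 (s≤s (s≤s z≤n))

      dead′ : ∀ i → i ℕ.< suc (suc j) → Y (s u) -[1+ 0 ] (+ i) ≡ false
      dead′ i i<j = trans (cong (λ w → Y w -[1+ 0 ] (+ i)) (s-D {u} Y₀₂-off))
                      (trans (Y-at u (+ 1) (+ 1) -[1+ 0 ] (+ i)) (dead i i<j))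

      meet : (∃ λ t → c (at (s u) -[1+ 0 ] (+ suc (suc j))) ≡ iter s t (s u)) →
             GridMeet s c u (u + + suc (suc (suc j)))
      meet (t , e) = suc t , 0 , 0 , 1 , sym (begin
        c (u + + suc (suc (suc j)))
          ≡⟨ cong c (at-at u (+ 1) (+ 1) -[1+ 0 ] (+ suc (suc j))) ⟨
        c (at (at u (+ 1) (+ 1)) -[1+ 0 ] (+ suc (suc j)))
          ≡⟨ cong (λ w → c (at w -[1+ 0 ] (+ suc (suc j)))) (s-D {u} Y₀₂-off) ⟨
        c (at (s u) -[1+ 0 ] (+ suc (suc j)))
          ≡⟨ e ⟩
        iter s t (s u)
          ≡⟨ iter-suc s t u ⟩
        iter s (suc t) u ∎)

  scan : ∀ r j {u} → Live u → (∀ i → i ℕ.< j → Y u (+ 0) (+ suc i) ≡ false) →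
         Live (u + + suc (j ℕ.+ r)) → GridMeet s c u (u + + suc (j ℕ.+ r))
  scan zero j {u} lu dead lt =
    subst (λ d → GridMeet s c u (u + + suc d)) (sym (+-identityʳ j))
      (next-live-meets j lu dead (subst (λ d → Live (u + + suc d)) (+-identityʳ j) lt))
  scan (suc r) j {u} lu dead lt = bool-cases (Y u (+ 0) (+ suc j))
    (λ on → gridMeet-trans lu on lt (next-live-meets j lu dead on)
              (subst (GridMeet s c _) regroup (scan r 0 on (λ _ ()) (subst Live (sym regroup) lt))))
    (λ off → subst (λ d → GridMeet s c u (u + + suc d)) (sym (+-suc j r))
               (scan r (suc j) lu (extend off) (subst (λ d → Live (u + + suc d)) (+-suc j r) lt)))
    where
      regroup : u + + suc j + + suc r ≡ u + + suc (j ℕ.+ suc r)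
      regroup = ℤ.+-assoc u (+ suc j) (+ suc r)

      extend : Y u (+ 0) (+ suc j) ≡ false → ∀ i → i ℕ.< suc j → Y u (+ 0) (+ suc i) ≡ false
      extend off i i<j with m<1+n⇒m<n∨m≡n i<j
      ... | inj₁ i<j′ = dead i i<j′
      ... | inj₂ refl = off

  private
    forward : ∀ {u v} → Live u → Live v → u ℤ.≤ v → GridMeet s c u v
    forward {u} {v} lu lv u≤v = subst (GridMeet s c u) reach (go ∣ v - u ∣ (subst Live (sym reach) lv))
      where
        reach : u + + ∣ v - u ∣ ≡ v
        reach = trans (cong (λ t → u + t) (ℤ.0≤i⇒+∣i∣≡i (ℤ.i≤j⇒0≤j-i u≤v))) (telescope u v)
          where
            telescope : ∀ u v → u + (v - u) ≡ v
            telescope = solve-∀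

        go : ∀ d → Live (u + + d) → GridMeet s c u (u + + d)
        go zero    _  = subst (GridMeet s c u) (sym (ℤ.+-identityʳ u)) (gridMeet-refl u)
        go (suc d) lt = scan d 0 lu (λ _ ()) lt

  grid-connected : ∀ {u v} → Live u → Live v → GridMeet s c u v
  grid-connected {u} {v} lu lv with ℤ.≤-total u v
  ... | inj₁ u≤v = forward lu lv u≤v
  ... | inj₂ v≤u = gridMeet-sym (forward lv lu v≤u)

module Toggling where

  open import Defs using (Config; Independent; csucc; update; toggle; sweep; unsweep; orbitPt; tape)
  open import Data.Bool using (Bool; true; false; not; _∨_; _∧_)
  import Data.Bool as Bool
  open import Data.Bool.Properties using (∧-identityʳ; ∧-zeroʳ; ∨-assoc; ∨-comm)
  open import Data.Nat using (ℕ; zero; suc; _%_; s≤s; z≤n)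
  import Data.Nat.Properties as ℕ
  open import Data.Nat.DivMod using (m<n⇒m%n≡m; n%n≡0)
  open import Data.Fin as Fin using (Fin; toℕ; fromℕ; inject₁)
  import Data.Fin.Properties as Fin
  open import Data.Fin.Properties using (all?)
  open import Data.Product using (∃; ∃₂; _×_; _,_; proj₁; proj₂)
  open import Data.List using (List; []; _∷_; _++_; map; foldl; foldr; allFin)
  import Data.List.Properties as List
  open import Data.List.Relation.Unary.All as All using (All; []; _∷_)
  import Data.List.Relation.Unary.All.Properties as All
  open import Data.Sum using (_⊎_; inj₁; inj₂)
  open import Data.Empty using (⊥-elim)
  open import Function using (_$_; _∘_)
  open import Relation.Nullary using (yes; no)
  open import Data.Integer as ℤ using (ℤ; +_; -[1+_]; _+_; _-_; _*_; +<+)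
  import Data.Integer.Properties as ℤ
  open import Data.Integer.DivMod using (_/ℕ_; _%ℕ_; n%ℕd<d; a≡a%ℕn+[a/ℕn]*n)
  open import Data.Integer.Tactic.RingSolver using (solve-∀)
  open import Relation.Binary using (tri<; tri≈; tri>)
  open import Relation.Binary.PropositionalEquality
  open ≡-Reasoning

  private
    row-order : ∀ {n q q′ r r′} → r ℕ.< n → q ℤ.< q′ → + r + q * + n ℤ.< + r′ + q′ * + n
    row-order {n} {q} {q′} {r} {r′} r<n q<q′ =
      ℤ.<-≤-trans (ℤ.+-monoˡ-< (q * + n) (+<+ r<n))
        (ℤ.≤-trans (ℤ.≤-reflexive (next-row q (+ n)))
          (ℤ.≤-trans (ℤ.*-monoʳ-≤-nonNeg (+ n) (ℤ.i<j⇒suc[i]≤j q<q′)) (ℤ.i≤j+i (q′ * + n) (+ r′))))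
      where
        next-row : ∀ q N → N + q * N ≡ (+ 1 + q) * N
        next-row = solve-∀

  divMod-unique : ∀ {n q₁ q₂ r₁ r₂} → r₁ ℕ.< n → r₂ ℕ.< n →
                  + r₁ + q₁ * + n ≡ + r₂ + q₂ * + n → q₁ ≡ q₂ × r₁ ≡ r₂
  divMod-unique {n} {q₁} {q₂} {r₁} {r₂} r₁<n r₂<n e with ℤ.<-cmp q₁ q₂
  ... | tri< q₁<q₂ _ _ = ⊥-elim (ℤ.<-irrefl e (row-order r₁<n q₁<q₂))
  ... | tri> _ _ q₂<q₁ = ⊥-elim (ℤ.<-irrefl (sym e) (row-order r₂<n q₂<q₁))
  ... | tri≈ _ refl _ = refl , ℤ.+-injective (trans (sym (cancel (+ r₁) (q₁ * + n)))
                                  (trans (cong (_- q₁ * + n) e) (cancel (+ r₂) (q₁ * + n))))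
    where
      cancel : ∀ a c → a + c - c ≡ a
      cancel = solve-∀

  allFin-split : ∀ {n} (j : Fin n) →
                 ∃₂ λ pre post → allFin n ≡ pre ++ j ∷ post × All (Fin._< j) pre × All (j Fin.<_) post
  allFin-split {suc n} Fin.zero =
    [] , map Fin.suc (allFin n) , allFin-suc , [] , All.map⁺ (All.universal (λ _ → s≤s z≤n) (allFin n))
    where
      allFin-suc : allFin (suc n) ≡ Fin.zero ∷ map Fin.suc (allFin n)
      allFin-suc = cong (Fin.zero ∷_) (sym (List.map-tabulate (λ i → i) Fin.suc))
  allFin-split {suc n} (Fin.suc j) with pre , post , split , pre<j , j<post ← allFin-split j =
    Fin.zero ∷ map Fin.suc pre , map Fin.suc post ,
    cong (Fin.zero ∷_) (trans (sym (List.map-tabulate (λ i → i) Fin.suc))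
      (trans (cong (map Fin.suc) split) (List.map-++ Fin.suc pre (j ∷ post)))) ,
    s≤s z≤n ∷ All.map⁺ (All.map s≤s pre<j) ,
    All.map⁺ (All.map s≤s j<post)

  -- n = m + 2: with fewer than two vertices, a vertex of C_n would be its own neighbour.
  module Cycle (m : ℕ) where

    n : ℕ
    n = suc (suc m)

    next : Fin n → Fin n
    next = csucc n

    prev : Fin n → Fin n
    prev Fin.zero    = fromℕ (suc m)
    prev (Fin.suc i) = inject₁ i

    toℕ-next : ∀ i → (toℕ i ≡ suc m × toℕ (next i) ≡ 0) ⊎ toℕ (next i) ≡ suc (toℕ i)
    toℕ-next i with ℕ.<-cmp (suc (toℕ i)) n
    ... | tri< lt _ _ = inj₂ (trans (Fin.toℕ-fromℕ< _) (m<n⇒m%n≡m lt))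
    ... | tri≈ _ eq _ = inj₁ (ℕ.suc-injective eq , trans (Fin.toℕ-fromℕ< _) (trans (cong (_% n) eq) (n%n≡0 n)))
    ... | tri> _ _ gt = ⊥-elim (ℕ.<⇒≱ gt (Fin.toℕ<n i))

    next-prev : ∀ i → next (prev i) ≡ i
    next-prev Fin.zero    = Fin.toℕ-injective (trans (Fin.toℕ-fromℕ< _)
      (trans (cong (λ t → suc t % n) (Fin.toℕ-fromℕ (suc m))) (n%n≡0 n)))
    next-prev (Fin.suc i) = Fin.toℕ-injective (trans (Fin.toℕ-fromℕ< _)
      (trans (cong (λ t → suc t % n) (Fin.toℕ-inject₁ i)) (m<n⇒m%n≡m (s≤s (Fin.toℕ<n i)))))

    next-injective : ∀ {i j} → next i ≡ next j → i ≡ j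
    next-injective {i} {j} e with toℕ-next i | toℕ-next j
    ... | inj₁ (i-last , _) | inj₁ (j-last , _) = Fin.toℕ-injective (trans i-last (sym j-last))
    ... | inj₁ (_ , i-0)    | inj₂ j-suc        with () ← trans (sym i-0) (trans (cong toℕ e) j-suc)
    ... | inj₂ i-suc        | inj₁ (_ , j-0)    with () ← trans (sym j-0) (trans (cong toℕ (sym e)) i-suc)
    ... | inj₂ i-suc        | inj₂ j-suc        =
      Fin.toℕ-injective (ℕ.suc-injective (trans (sym i-suc) (trans (cong toℕ e) j-suc)))

    next-≢ : ∀ i → next i ≢ i
    next-≢ i e with toℕ-next i
    ... | inj₁ (i-last , i-0) with () ← trans (sym i-0) (trans (cong toℕ e) i-last)
    ... | inj₂ i-suc = ℕ.1+n≢n (trans (sym i-suc) (cong toℕ e))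

    prev-≢ : ∀ i → prev i ≢ i
    prev-≢ i e = next-≢ i (trans (cong next (sym e)) (next-prev i))

    prev-unique : ∀ {i j} → next i ≡ j → i ≡ prev j
    prev-unique e = next-injective (trans e (sym (next-prev _)))

    private
      Ind : Config n → Set
      Ind = Independent n

      ∧≡false-right : ∀ {a b} → a ≡ true → a ∧ b ≡ false → b ≡ false
      ∧≡false-right refl h = h

      ∧≡false-left : ∀ {a b} → b ≡ true → a ∧ b ≡ false → a ≡ false
      ∧≡false-left {a} refl h = trans (sym (∧-identityʳ a)) h

    update-same : ∀ (w : Config n) k b → update n w k b k ≡ b
    update-same w k b with k Fin.≟ k
    ... | yes _  = refl
    ... | no k≢k = ⊥-elim (k≢k refl)

    update-other : ∀ (w : Config n) k b j → j ≢ k → update n w k b j ≡ w j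
    update-other w k b j j≢k with j Fin.≟ k
    ... | yes j≡k = ⊥-elim (j≢k j≡k)
    ... | no _    = refl

    toggle-other : ∀ k (w : Config n) j → j ≢ k → toggle n k w j ≡ w j
    toggle-other k w j j≢k with w k
    ... | true = update-other w k false j j≢k
    ... | false with all? (λ i → update n w k true i ∧ update n w k true (next i) Bool.≟ false)
    ...   | yes _ = update-other w k true j j≢k
    ...   | no  _ = refl

    neighbours-off : ∀ (w : Config n) k → Ind w → w k ≡ true → w (prev k) ≡ false × w (next k) ≡ false
    neighbours-off w k ind on =
      ∧≡false-left (trans (cong w (next-prev k)) on) (ind (prev k)) , ∧≡false-right on (ind k)

    toggle-at : ∀ k (w : Config n) → Ind w → toggle n k w k ≡ not (w k ∨ w (prev k) ∨ w (next k))
    toggle-at k w ind with w k in wk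
    ... | true = update-same w k false
    ... | false with all? (λ i → update n w k true i ∧ update n w k true (next i) Bool.≟ false)
    ...   | yes still-ind = trans (update-same w k true) (sym (cong₂ (λ a b → not (a ∨ b)) prev-off next-off))
      where
        prev-off : w (prev k) ≡ false
        prev-off = ∧≡false-left (trans (cong (update n w k true) (next-prev k)) (update-same w k true))
          (trans (cong (λ a → a ∧ update n w k true (next (prev k))) (sym (update-other w k true (prev k) (prev-≢ k))))
            (still-ind (prev k)))
        next-off : w (next k) ≡ false
        next-off = ∧≡false-right (update-same w k true)
          (trans (cong (λ b → update n w k true k ∧ b) (sym (update-other w k true (next k) (next-≢ k))))
            (still-ind k))
    ...   | no not-ind = trans wk (sym (cong not neighbour-on))
      where
        neighbour-on : w (prev k) ∨ w (next k) ≡ true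
        neighbour-on with w (prev k) in wp | w (next k) in wn
        ... | true  | _     = refl
        ... | false | true  = refl
        ... | false | false = ⊥-elim (not-ind still-ind)
          where
            still-ind : ∀ i → update n w k true i ∧ update n w k true (next i) ≡ false
            still-ind i with i Fin.≟ k
            ... | yes refl = trans (update-other w i true (next i) (next-≢ i)) wn
            ... | no i≢k with next i Fin.≟ k
            ...   | yes next-i≡k = trans (∧-identityʳ (w i)) (trans (cong w (prev-unique next-i≡k)) wp)
            ...   | no  _        = ind i

    private
      toggled-then-next : ∀ a b c → not (a ∨ b ∨ c) ∧ c ≡ false
      toggled-then-next a     b     false = ∧-zeroʳ _
      toggled-then-next true  b     true  = refl
      toggled-then-next false true  true  = refl
      toggled-then-next false false true  = refl

      prev-then-toggled : ∀ a b c → b ∧ not (a ∨ b ∨ c) ≡ false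
      prev-then-toggled a     false c = refl
      prev-then-toggled true  true  c = refl
      prev-then-toggled false true  c = refl

    toggle-independent : ∀ k (w : Config n) → Ind w → Ind (toggle n k w)
    toggle-independent k w ind i with i Fin.≟ k
    ... | yes refl = trans (cong₂ _∧_ (toggle-at i w ind) (toggle-other i w (next i) (next-≢ i)))
                       (toggled-then-next (w i) (w (prev i)) (w (next i)))
    ... | no i≢k with next i Fin.≟ k
    ...   | yes next-i≡k =
      subst (λ i → toggle n k w i ∧ toggle n k w (next i) ≡ false) (sym (prev-unique next-i≡k)) $
      trans (cong₂ _∧_ (toggle-other k w (prev k) (prev-≢ k))
                       (trans (cong (toggle n k w) (next-prev k)) (toggle-at k w ind)))
        (prev-then-toggled (w k) (w (prev k)) (w (next k)))
    ...   | no next-i≢k = trans (cong₂ _∧_ (toggle-other k w i i≢k) (toggle-other k w (next i) next-i≢k)) (ind i)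

    toggle-cong : ∀ k {w w′ : Config n} → Ind w → Ind w′ → (∀ j → w j ≡ w′ j) →
                  ∀ j → toggle n k w j ≡ toggle n k w′ j
    toggle-cong k {w} {w′} ind ind′ w≗w′ j with j Fin.≟ k
    ... | no j≢k   = trans (toggle-other k w j j≢k) (trans (w≗w′ j) (sym (toggle-other k w′ j j≢k)))
    ... | yes refl = trans (toggle-at j w ind)
                       (trans (cong₂ (λ a b → not (a ∨ b)) (w≗w′ j) (cong₂ _∨_ (w≗w′ (prev j)) (w≗w′ (next j))))
                         (sym (toggle-at j w′ ind′)))

    toggle-involutive : ∀ k (w : Config n) → Ind w → ∀ j → toggle n k (toggle n k w) j ≡ w j
    toggle-involutive k w ind j with j Fin.≟ k
    ... | no j≢k   = trans (toggle-other k (toggle n k w) j j≢k) (toggle-other k w j j≢k)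
    ... | yes refl = begin
        toggle n j (toggle n j w) j
          ≡⟨ toggle-at j (toggle n j w) (toggle-independent j w ind) ⟩
        not (toggle n j w j ∨ toggle n j w (prev j) ∨ toggle n j w (next j))
          ≡⟨ cong₂ (λ a b → not (a ∨ b)) (toggle-at j w ind)
               (cong₂ _∨_ (toggle-other j w (prev j) (prev-≢ j)) (toggle-other j w (next j) (next-≢ j))) ⟩
        not (not (w j ∨ w (prev j) ∨ w (next j)) ∨ w (prev j) ∨ w (next j))
          ≡⟨ untoggle (w j) (w (prev j)) (w (next j)) (neighbours-off w j ind) ⟩
        w j ∎
      where
        untoggle : ∀ a b c → (a ≡ true → b ≡ false × c ≡ false) → not (not (a ∨ b ∨ c) ∨ b ∨ c) ≡ a
        untoggle true  b c off with refl , refl ← off refl = refl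
        untoggle false true  c     _ = refl
        untoggle false false true  _ = refl
        untoggle false false false _ = refl

    toggles : Config n → List (Fin n) → Config n
    toggles = foldl (λ y k → toggle n k y)

    untoggles : List (Fin n) → Config n → Config n
    untoggles ks y = foldr (λ k y → toggle n k y) y ks

    toggles-independent : ∀ ks (w : Config n) → Ind w → Ind (toggles w ks)
    toggles-independent []       w ind = ind
    toggles-independent (k ∷ ks) w ind = toggles-independent ks (toggle n k w) (toggle-independent k w ind)

    untoggles-independent : ∀ ks (w : Config n) → Ind w → Ind (untoggles ks w)
    untoggles-independent []       w ind = ind
    untoggles-independent (k ∷ ks) w ind = toggle-independent k (untoggles ks w) (untoggles-independent ks w ind)

    toggles-cong : ∀ ks {w w′ : Config n} → Ind w → Ind w′ → (∀ j → w j ≡ w′ j) →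
                   ∀ j → toggles w ks j ≡ toggles w′ ks j
    toggles-cong []       _   _    w≗w′ = w≗w′
    toggles-cong (k ∷ ks) {w} {w′} ind ind′ w≗w′ =
      toggles-cong ks (toggle-independent k w ind) (toggle-independent k w′ ind′) (toggle-cong k ind ind′ w≗w′)

    toggles-untoggles : ∀ ks (y : Config n) → Ind y → ∀ j → toggles (untoggles ks y) ks j ≡ y j
    toggles-untoggles []       y ind j = refl
    toggles-untoggles (k ∷ ks) y ind j =
      trans (toggles-cong ks (toggle-independent k (toggle n k u) (toggle-independent k u ind-u)) ind-u
               (toggle-involutive k u ind-u) j)
            (toggles-untoggles ks y ind j)
      where
        u = untoggles ks y
        ind-u = untoggles-independent ks y ind

    toggles-frame : ∀ ks (w : Config n) j → All (_≢ j) ks → toggles w ks j ≡ w j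
    toggles-frame []       w j []           = refl
    toggles-frame (k ∷ ks) w j (k≢j ∷ ks≢j) =
      trans (toggles-frame ks (toggle n k w) j ks≢j) (toggle-other k w j (k≢j ∘ sym))

    sweep-independent : ∀ (y : Config n) → Ind y → Ind (sweep n y)
    sweep-independent y = toggles-independent (allFin n) y

    unsweep-independent : ∀ (y : Config n) → Ind y → Ind (unsweep n y)
    unsweep-independent y = untoggles-independent (allFin n) y

    sweep-unsweep : ∀ (y : Config n) → Ind y → ∀ j → sweep n (unsweep n y) j ≡ y j
    sweep-unsweep = toggles-untoggles (allFin n)

    -- τ_j acts on the state W reached after τ_1, …, τ_{j-1}: new values before j,
    -- old values from j on.
    sweep-at : ∀ (y : Config n) → Ind y → ∀ j →
               ∃ λ (W : Config n) → sweep n y j ≡ not (y j ∨ W (prev j) ∨ W (next j)) ×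
                 (∀ i → i Fin.< j → W i ≡ sweep n y i) × (∀ i → j Fin.≤ i → W i ≡ y i)
    sweep-at y ind j with pre , post , split , pre<j , j<post ← allFin-split j =
      W , (begin
        sweep n y j
          ≡⟨ before-post j ℕ.≤-refl ⟩
        toggle n j W j
          ≡⟨ toggle-at j W (toggles-independent pre y ind) ⟩
        not (W j ∨ W (prev j) ∨ W (next j))
          ≡⟨ cong (λ b → not (b ∨ W (prev j) ∨ W (next j))) (from-j-on j ℕ.≤-refl) ⟩
        not (y j ∨ W (prev j) ∨ W (next j)) ∎) ,
      (λ i i<j → sym (trans (before-post i (ℕ.<⇒≤ i<j)) (toggle-other j W i (Fin.<⇒≢ i<j)))) ,
      from-j-on
      where
        W = toggles y pre

        sweep-split : ∀ i → sweep n y i ≡ toggles (toggle n j W) post i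
        sweep-split i = cong (λ z → z i) (trans (cong (toggles y) split) (List.foldl-++ _ y pre (j ∷ post)))

        before-post : ∀ i → i Fin.≤ j → sweep n y i ≡ toggle n j W i
        before-post i i≤j = trans (sweep-split i) (toggles-frame post _ i
          (All.map (λ j<k k≡i → ℕ.<⇒≱ j<k (subst (Fin._≤ j) (sym k≡i) i≤j)) j<post))

        from-j-on : ∀ i → j Fin.≤ i → W i ≡ y i
        from-j-on i j≤i = toggles-frame pre y i
          (All.map (λ k<j k≡i → ℕ.<⇒≱ k<j (subst (j Fin.≤_) (sym k≡i) j≤i)) pre<j)

    toℕ-prev : ∀ i → (i ≡ Fin.zero × toℕ (prev i) ≡ suc m) ⊎ suc (toℕ (prev i)) ≡ toℕ i
    toℕ-prev Fin.zero    = inj₁ (refl , Fin.toℕ-fromℕ (suc m))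
    toℕ-prev (Fin.suc i) = inj₂ (cong suc (Fin.toℕ-inject₁ i))

    module Ticker (x : Config n) (ind : Ind x) where

      N : ℤ
      N = + n

      X : ℤ → Bool
      X = tape n x

      Row : ℤ → Config n
      Row = orbitPt n x

      row-independent : ∀ q → Ind (Row q)
      row-independent (+ i)    = iter-invariant {f = sweep n} sweep-independent i x ind
      row-independent -[1+ i ] = iter-invariant {f = unsweep n} unsweep-independent (suc i) x ind

      row-suc : ∀ q j → Row (+ 1 + q) j ≡ sweep n (Row q) j
      row-suc (+ i)          j = refl
      row-suc -[1+ zero ]    j = sym (sweep-unsweep x ind j)
      row-suc -[1+ suc i ]   j = sym (sweep-unsweep (Row -[1+ i ]) (row-independent -[1+ i ]) j)

      -- Entry k of the tape is entry r (0-based) of row q when k = 1 + r + q n.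
      tape-at : ∀ {k} q (r : Fin n) → k ≡ + 1 + (+ toℕ r + q * N) → X k ≡ Row q r
      tape-at {k} q r k≡ = cong₂ Row (proj₁ qr) (Fin.toℕ-injective (trans (Fin.toℕ-fromℕ< _) (proj₂ qr)))
        where
          k-1≡ : k - + 1 ≡ + toℕ r + q * N
          k-1≡ = trans (cong (_- + 1) k≡) (drop-one (+ toℕ r + q * N))
            where
              drop-one : ∀ t → + 1 + t - + 1 ≡ t
              drop-one = solve-∀

          qr : (k - + 1) /ℕ n ≡ q × (k - + 1) %ℕ n ≡ toℕ r
          qr = divMod-unique (n%ℕd<d (k - + 1) n) (Fin.toℕ<n r) (trans (sym (a≡a%ℕn+[a/ℕn]*n (k - + 1) n)) k-1≡)

      row : ℤ → ℤ
      row k = (k - + 1) /ℕ n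

      column : ℤ → Fin n
      column k = Fin.fromℕ< (n%ℕd<d (k - + 1) n)

      position : ∀ k → k ≡ + 1 + (+ toℕ (column k) + row k * N)
      position k = trans (sym (add-one k)) (cong (λ t → + 1 + t)
        (trans (a≡a%ℕn+[a/ℕn]*n (k - + 1) n) (cong (λ t → + t + row k * N) (sym (Fin.toℕ-fromℕ< _)))))
        where
          add-one : ∀ k → + 1 + (k - + 1) ≡ k
          add-one = solve-∀

      recurrence-at : ∀ {k} q r → k ≡ + 1 + (+ toℕ r + q * N) →
                      X k ≡ not (X (k - + 1) ∨ X (k - N) ∨ X (k - N + + 1))
      recurrence-at {k} q r k≡ with sweep-at (Row (q - + 1)) (row-independent (q - + 1)) r
      ... | W , value , new , old = begin
        X k                                              ≡⟨ tape-at q r k≡ ⟩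
        Row q r                                          ≡⟨ row-q r ⟩
        sweep n (Row p) r                                ≡⟨ value ⟩
        not (Row p r ∨ W (prev r) ∨ W (next r))          ≡⟨ cong not (swap (Row p r) (W (prev r)) (W (next r))) ⟩
        not (W (prev r) ∨ Row p r ∨ W (next r))          ≡⟨ cong₂ (λ a b → not (a ∨ b)) left (cong₂ _∨_ up upright) ⟨
        not (X (k - + 1) ∨ X (k - N) ∨ X (k - N + + 1))  ∎
        where
          p = q - + 1
          R = + toℕ r

          swap : ∀ a b c → a ∨ b ∨ c ≡ b ∨ a ∨ c
          swap a b c = trans (sym (∨-assoc a b c)) (trans (cong (_∨ c) (∨-comm a b)) (∨-assoc b a c))

          row-q : ∀ j → Row q j ≡ sweep n (Row p) j
          row-q j = trans (cong (λ t → Row t j) (unshift q)) (row-suc p j)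
            where
              unshift : ∀ q → q ≡ + 1 + (q - + 1)
              unshift = solve-∀

          up : X (k - N) ≡ Row p r
          up = tape-at p r (trans (cong (_- N) k≡) (shift R q N))
            where
              shift : ∀ R q N → + 1 + (R + q * N) - N ≡ + 1 + (R + (q - + 1) * N)
              shift = solve-∀

          left : X (k - + 1) ≡ W (prev r)
          left with toℕ-prev r
          ... | inj₁ (refl , prev-last) =
            trans (tape-at p (prev r) (trans (cong (_- + 1) k≡)
                    (trans (wrap q (+ suc m)) (cong (λ t → + 1 + (+ t + p * N)) (sym prev-last)))))
                  (sym (old (prev r) z≤n))
            where
              wrap : ∀ q M → + 1 + (+ 0 + q * (+ 1 + M)) - + 1 ≡ + 1 + (M + (q - + 1) * (+ 1 + M))
              wrap = solve-∀
          ... | inj₂ prev-suc =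
            trans (tape-at q (prev r) (trans (cong (_- + 1) k≡)
                    (trans (cong (λ t → + 1 + (+ t + q * N) - + 1) (sym prev-suc)) (step-back (+ toℕ (prev r)) q N))))
                  (trans (row-q (prev r)) (sym (new (prev r) (ℕ.≤-reflexive prev-suc))))
            where
              step-back : ∀ R′ q N → + 1 + ((+ 1 + R′) + q * N) - + 1 ≡ + 1 + (R′ + q * N)
              step-back = solve-∀

          upright : X (k - N + + 1) ≡ W (next r)
          upright with toℕ-next r
          ... | inj₁ (r-last , next-0) =
            trans (tape-at q (next r) (trans (cong (λ t → t - N + + 1) k≡)
                    (trans (cong (λ t → + 1 + (+ t + q * N) - N + + 1) r-last)
                      (trans (wrap q (+ suc m)) (cong (λ t → + 1 + (+ t + q * N)) (sym next-0))))))
                  (trans (row-q (next r)) (sym (new (next r) (subst (ℕ._< toℕ r) (sym next-0)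
                    (subst (0 ℕ.<_) (sym r-last) (s≤s z≤n))))))
            where
              wrap : ∀ q M → + 1 + (M + q * (+ 1 + M)) - (+ 1 + M) + + 1 ≡ + 1 + (+ 0 + q * (+ 1 + M))
              wrap = solve-∀
          ... | inj₂ next-suc =
            trans (tape-at p (next r) (trans (cong (λ t → t - N + + 1) k≡)
                    (trans (step-up R q N) (cong (λ t → + 1 + (+ t + p * N)) (sym next-suc)))))
                  (sym (old (next r) (subst (toℕ r ℕ.≤_) (sym next-suc) (ℕ.n≤1+n (toℕ r)))))
            where
              step-up : ∀ R q N → + 1 + (R + q * N) - N + + 1 ≡ + 1 + ((+ 1 + R) + (q - + 1) * N)
              step-up = solve-∀

      recurrence : Tape.Recurrence n X
      recurrence k = recurrence-at (row k) (column k) (position k)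

open Toggling

module Degrees (n : ℕ) .{{_ : NonZero n}} (2≤n : 2 ℕ.≤ n) (x : Config n)
               (rec : Tape.Recurrence n (tape n x)) where

  open import Defs using (iter; Config; tape; NumSnakes; NumCoSnakes; IsDeg; IsCodeg; LengthOverPeriod)
  open import Data.Nat using (ℕ; suc; _*_; NonZero; s≤s; z≤n)
  import Data.Nat.Properties as ℕ
  open import Data.Nat.Coprimality using (Coprime)
  open import Data.Nat.Divisibility using (_∣_)
  open import Data.Integer as ℤ using (ℤ; +_; _-_)
  import Data.Integer.Properties as ℤ
  open import Data.Integer.Tactic.RingSolver using (solve-∀)
  open import Data.Product using (∃; _×_; _,_)
  open import Data.Empty using (⊥-elim)
  open import Relation.Binary.PropositionalEquality
  open ≡-Reasoning

  open Tape n (tape n x)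
  open Automaton rec
  open Connectivity n (tape n x) rec
  open CommutingPair Live s-live c-live s-injective c-injective s-c-commute
                     s-inflationary (c-inflationary 2≤n) grid-connected

  module _ {α β k} (snakes : NumSnakes n x α) (cosnakes : NumCoSnakes n x β) (lk : Live k) where

    meet : iter s β k ≡ iter c α k
    meet = snake-meets-cosnake snakes cosnakes lk

    s-type-periodic : Periodic (λ j → s-type (iter s j k)) β
    s-type-periodic j = begin
      s-type (iter s (β ℕ.+ j) k)          ≡⟨ cong (λ t → s-type (iter s t k)) (ℕ.+-comm β j) ⟩
      s-type (iter s (j ℕ.+ β) k)          ≡⟨ cong s-type (iter-+ s j β k) ⟩
      s-type (iter s j (iter s β k))       ≡⟨ cong (λ y → s-type (iter s j y)) meet ⟩
      s-type (iter s j (iter c α k))       ≡⟨ cong s-type (FG.commute j α lk) ⟩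
      s-type (iter c α (iter s j k))       ≡⟨ iter-constant s-type c-live s-type-c α _ (iter-invariant s-live j k lk) ⟩
      s-type (iter s j k)                  ∎

    c-type-periodic : Periodic (λ j → c-type (iter c j k)) α
    c-type-periodic j = begin
      c-type (iter c (α ℕ.+ j) k)          ≡⟨ cong (λ t → c-type (iter c t k)) (ℕ.+-comm α j) ⟩
      c-type (iter c (j ℕ.+ α) k)          ≡⟨ cong c-type (iter-+ c j α k) ⟩
      c-type (iter c j (iter c α k))       ≡⟨ cong (λ y → c-type (iter c j y)) (sym meet) ⟩
      c-type (iter c j (iter s β k))       ≡⟨ cong c-type (FG.commute β j lk) ⟨
      c-type (iter s β (iter c j k))       ≡⟨ iter-constant c-type s-live c-type-s β _ (iter-invariant c-live j k lk) ⟩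
      c-type (iter c j k)                  ∎

    private
      α≢0 : NonZero α
      α≢0 = orbitCount-pos {k = k} snakes lk

      β≢0 : NonZero β
      β≢0 = orbitCount-pos {k = k} cosnakes lk

    snake-split : ∀ {d} → IsDeg n x k β d → ∀ {i} → i ∣ d →
                  ∃ λ m → β ≡ i * m × iter s β k - k ≡ + i ℤ.* (iter s m k - k)
    snake-split {d} deg = divisor-displacement s s-type σ s-displacement k β {{β≢0}} s-type-periodic
                        (subst (λ w → LengthOverPeriod w d) (stepWord-applyUpTo n s s-type k β) deg)

    cosnake-split : ∀ {e} → IsCodeg n x k α e → ∀ {i} → i ∣ e →
                    ∃ λ l → α ≡ i * l × iter c α k - k ≡ + i ℤ.* (iter c l k - k)
    cosnake-split {e} codeg = divisor-displacement c c-type γ c-displacement k α {{α≢0}} c-type-periodic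
                            (subst (λ w → LengthOverPeriod w e) (stepWord-applyUpTo n c c-type k α) codeg)

    -- A common divisor i ≥ 2 of the degrees would give s^(β/i) k = c^(α/i) k,
    -- an early return of the co-snake to the snake of k.
    common-divisor-trivial : ∀ i →
      (∃ λ m → β ≡ i * m × iter s β k - k ≡ + i ℤ.* (iter s m k - k)) →
      (∃ λ l → α ≡ i * l × iter c α k - k ≡ + i ℤ.* (iter c l k - k)) → i ≡ 1
    common-divisor-trivial 0 (_ , β≡0 , _) _ = ⊥-elim (ℕ.≢-nonZero⁻¹ β {{β≢0}} β≡0)
    common-divisor-trivial 1 _ _ = refl
    common-divisor-trivial i@(suc (suc _)) (m , _ , sᵝ) (l , α≡il , cᵅ) =
      ⊥-elim (FG.no-early-return lk snakes l (ℕ.>-nonZero⁻¹ l {{l≢0}}) l<α (m , 0 , sᵐ≡cˡ))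
      where
        l≢0 : NonZero l
        l≢0 = ℕ.m*n≢0⇒n≢0 i {{subst NonZero α≡il α≢0}}

        l<α : l ℕ.< α
        l<α = subst (l ℕ.<_) (trans (ℕ.*-comm l i) (sym α≡il)) (ℕ.m<m*n l i {{l≢0}} (s≤s (s≤s z≤n)))

        sᵐ≡cˡ : iter s m k ≡ iter c l k
        sᵐ≡cˡ = cancel-k (ℤ.*-cancelˡ-≡ (+ i) _ _ (trans (sym sᵝ) (trans (cong (_- k) meet) cᵅ)))
          where
            cancel-k : ∀ {a b} → a - k ≡ b - k → a ≡ b
            cancel-k {a} {b} e = trans (sym (add-back a k)) (trans (cong (ℤ._+ k) e) (add-back b k))
              where
                add-back : ∀ a k → a - k ℤ.+ k ≡ a
                add-back = solve-∀

    coprime : ∀ {d e} → IsDeg n x k β d → IsCodeg n x k α e → Coprime d e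
    coprime deg codeg (i∣d , i∣e) = common-divisor-trivial _ (snake-split deg i∣d) (cosnake-split codeg i∣e)

open import Defs using (Independent; NumSnakes; NumCoSnakes; Live; IsDeg; IsCodeg)
open import Data.Nat using (_≤_; suc; s≤s)
open import Data.Nat.Coprimality using (Coprime)

lemma2p16 : (n : ℕ) .{{_ : NonZero n}} → 2 ≤ n →
    (x : Config n) → Independent n x →
    (α β : ℕ) → NumSnakes n x α → NumCoSnakes n x β →
    (k : ℤ) → Live n x k →
    (d e : ℕ) → IsDeg n x k β d → IsCodeg n x k α e →
    Coprime d e
lemma2p16 1 (s≤s ())
lemma2p16 n@(suc (suc m)) 2≤n x ind α β snakes cosnakes k lk d e =
  Degrees.coprime n 2≤n x (Cycle.Ticker.recurrence m x ind) snakes cosnakes lk
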